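{- Let $G=\mathbf{Z}/2\mathbf{Z}\times\mathbf{Z}/2\mathbf{Z}$. Then $X^{1/3}\lesssim N'_G(X)\lesssim X^{1/3}$.
   Context: Every elliptic curve $E/\mathbf{Q}$ has a unique equation $y^2=x^3+Ax+B$ with $A,B\in\mathbf{Z}$ such that $\gcd(A^3,B^2)$ is not divisible by $d^{12}$ for any integer $d>1$; the height of $E$ is $\max(|A|^3,|B|^2)$. $N'_G(X)$ is the number of isomorphism classes of elliptic curves $E/\mathbf{Q}$ of height at most $X$ such that $E(\mathbf{Q})$ contains a subgroup isomorphic to $G$. For functions $F,H$ of $X$, $F\lesssim H$ means there is $c>0$ with $F(X)\le cH(X)$ for all $X\ge1$. -}

module Defs where

open import Data.Nat as ℕ using (ℕ; zero; suc)
open import Data.Nat.GCD using (gcd)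
open import Data.Nat.Divisibility using (_∣_)
open import Data.Integer as ℤ using (ℤ; ∣_∣)
open import Data.Rational as ℚ using (ℚ; 0ℚ; 1ℚ; _÷_; ≢-nonZero)
open import Data.Rational.Properties using (_≟_)
open import Data.Fin using (Fin; zero; suc)
open import Data.Product using (Σ; _×_; _,_; ∃-syntax)
open import Data.Maybe using (Maybe; just; nothing)
open import Data.List using (List; length)
open import Data.List.Membership.Propositional using (_∈_)
open import Data.List.Relation.Unary.Unique.Propositional using (Unique)
open import Relation.Nullary using (¬_; yes; no)
open import Relation.Binary.PropositionalEquality using (_≡_; _≢_)
open import Function using (_∘_)

NonSingular : ℤ → ℤ → Set
NonSingular A B = (ℤ.+ 4) ℤ.* (A ℤ.* A ℤ.* A) ℤ.+ (ℤ.+ 27) ℤ.* (B ℤ.* B) ≢ ℤ.+ 0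

Minimal : ℤ → ℤ → Set
Minimal A B = (d : ℕ) → 2 ℕ.≤ d → ¬ ((d ℕ.^ 12) ∣ gcd (∣ A ∣ ℕ.^ 3) (∣ B ∣ ℕ.^ 2))

height : ℤ → ℤ → ℕ
height A B = (∣ A ∣ ℕ.^ 3) ℕ.⊔ (∣ B ∣ ℕ.^ 2)

-- total division on ℚ (only ever used with nonzero divisor below)
_/'_ : ℚ → ℚ → ℚ
p /' q with q ≟ 0ℚ
... | yes _ = 0ℚ
... | no q≢0 = _÷_ p q {{≢-nonZero q≢0}}

-- a point of the projective curve: nothing = point at infinity O,
-- just (x , y) = affine point
Point : Set
Point = Maybe (ℚ × ℚ)

O : Point
O = nothing

OnCurve : ℤ → ℤ → Point → Set
OnCurve A B nothing = Data.Unit.⊤ where import Data.Unit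
OnCurve A B (just (x , y)) = y ℚ.* y ≡ x ℚ.* x ℚ.* x ℚ.+ (A ℚ./ 1) ℚ.* x ℚ.+ (B ℚ./ 1)

private
  fromSlope : ℚ → ℚ → ℚ → ℚ → Point
  fromSlope λ' x₁ x₂ y₁ =
    let x₃ = λ' ℚ.* λ' ℚ.- x₁ ℚ.- x₂
    in just (x₃ , λ' ℚ.* (x₁ ℚ.- x₃) ℚ.- y₁)

addE : ℤ → ℤ → Point → Point → Point
addE A B nothing Q = Q
addE A B (just P) nothing = just P
addE A B (just (x₁ , y₁)) (just (x₂ , y₂)) with x₁ ≟ x₂
... | no _ = fromSlope ((y₂ ℚ.- y₁) /' (x₂ ℚ.- x₁)) x₁ x₂ y₁
... | yes _ with y₁ ≟ ℚ.- y₂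
...   | yes _ = O
...   | no _ = fromSlope (((ℤ.+ 3 ℚ./ 1) ℚ.* x₁ ℚ.* x₁ ℚ.+ (A ℚ./ 1))
                           /' ((ℤ.+ 2 ℚ./ 1) ℚ.* y₁)) x₁ x₂ y₁

Z2 : Set
Z2 = Fin 2

_+₂_ : Z2 → Z2 → Z2
zero +₂ b = b
suc zero +₂ zero = suc zero
suc zero +₂ suc zero = zero

G : Set
G = Z2 × Z2

_+G_ : G → G → G
(a , b) +G (c , d) = (a +₂ c , b +₂ d)

HasSubgroupG : ℤ → ℤ → Set
HasSubgroupG A B =
  Σ (G → Point) λ f →
    ((g : G) → OnCurve A B (f g))
    × ((g h : G) → f (g +G h) ≡ addE A B (f g) (f h))
    × ((g h : G) → f g ≡ f h → g ≡ h)

IsCount : (ℤ × ℤ → Set) → ℕ → Set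
IsCount P n =
  ∃[ L ] Unique L
       × ((ab : ℤ × ℤ) → (ab ∈ L → P ab) × (P ab → ab ∈ L))
       × length L ≡ n

-- the curves counted by N'_G(X): minimal models (A , B) (one per
-- isomorphism class) of height ≤ X with G ↪ E(ℚ)
CountedG : ℕ → ℤ × ℤ → Set
CountedG X (A , B) =
  NonSingular A B × Minimal A B × height A B ℕ.≤ X × HasSubgroupG A B

module Submission where

-- E : y² = x³ + A x + B has E(ℚ) ⊇ G iff the cubic has three distinct rational roots
-- (the points of order two are the (r , 0)); by the rational root theorem they are
-- integers a, b, -(a + b), so (A , B) = Φ (a , b) = (-(a² + ab + b²) , ab(a + b))
-- (§1–§4).  Since 4 ∣ A ∣ = 3a² + (a + 2b)² ≥ 3a², the roots are bounded by A (§5), which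
-- makes the counted set a decidable subset of a finite box; its size n = N'_G(X) is the
-- length of a filtered list (§6–§9).
-- Upper bound (§10): every counted curve is Φ of a pair in the box ∣ a ∣, ∣ b ∣ ≤ R with
-- R⁶ ≤ 3 X, so n ≤ (2R + 1)² and n³ ≤ 3⁷ X.
-- Lower bound (§11–§13): for coprime 1 ≤ a , c ≤ N the curves Φ (a , a + c) are distinct
-- minimal models of height ≤ 343 N⁶, and at least N² / 4 such pairs exist since the
-- non-coprime ones are covered by d · [1 , N / d]² with Σ_{d ≥ 2} 1/d² ≤ ¾.  Taking N
-- maximal with 343 N⁶ ≤ X gives X ≤ C n³.

open import Defs
open import Data.Nat using (ℕ; _≤_; _*_; _^_)
open import Data.Product using (_×_; ∃-syntax)

open import Data.Nat as ℕ using (zero; suc; _<_; s≤s; z≤n; _+_; _/_)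
import Data.Nat.Properties as ℕP
import Data.Nat.DivMod as DM
import Data.Nat.Divisibility as ND
import Data.Nat.GCD as GCD
import Data.Nat.Coprimality as C
open import Data.Nat.Primality using (Prime; euclidsLemma; ¬prime[1])
open import Data.Nat.Primality.Factorisation using (factorise)
open import Data.Nat.ListAction using (product)
import Data.Nat.Solver as ℕ-Solver
open import Data.Nat.Tactic.RingSolver as ℕ-Ring using ()
open import Data.Integer as ℤ using (ℤ; +_; -[1+_]; ∣_∣)
import Data.Integer.Properties as ℤP
open import Data.Integer.Tactic.RingSolver as ℤ-Ring using ()
open import Data.Rational as ℚ using (ℚ; mkℚ; 0ℚ)
import Data.Rational.Properties as ℚP
import Data.Rational.Unnormalised as ℚᵘ
import Data.Rational.Unnormalised.Properties as ℚᵘP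
import Data.Rational.Solver as ℚ-Solver
open import Data.Maybe using (just; nothing)
open import Data.Product using (Σ; _,_; proj₁; proj₂)
open import Data.Fin using (zero; suc)
open import Data.Sum using (_⊎_; inj₁; inj₂)
open import Data.List using (List; []; _∷_; length; map; _++_; filter; cartesianProduct; upTo)
import Data.List.Properties as LP
open import Data.List.Membership.Propositional using (_∈_; lose)
import Data.List.Membership.Propositional.Properties as MP
open import Data.List.Relation.Unary.Any using (here; there; index; _─_; any?; satisfied)
open import Data.List.Relation.Unary.All as All using (_∷_)
import Data.List.Relation.Unary.All.Properties as AllP
open import Data.List.Relation.Unary.AllPairs using ([]; _∷_)
open import Data.List.Relation.Unary.Unique.Propositional using (Unique)
import Data.List.Relation.Unary.Unique.Propositional.Properties as UP
open import Data.Empty using (⊥; ⊥-elim)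
open import Function using (case_of_; _∘_)
open import Relation.Nullary using (Dec; yes; no; ¬_; ¬?)
open import Relation.Nullary.Decidable using (_×-dec_; _→-dec_; map′)
open import Relation.Binary.PropositionalEquality

-- §1  ℤ inside ℚ.  Defs writes an integer coefficient as i / 1; this embedding is an
-- injective ring homomorphism.

ι : ℤ → ℚ
ι i = i ℚ./ 1

ι≡mkℚ : ∀ i → ι i ≡ mkℚ i 0 (C.sym (C.1-coprimeTo ∣ i ∣))
ι≡mkℚ (+ n)    = ℚP.normalize-coprime (C.sym (C.1-coprimeTo n))
ι≡mkℚ -[1+ n ] = cong ℚ.-_ (ℚP.normalize-coprime (C.sym (C.1-coprimeTo (suc n))))

toℚᵘ-ι : ∀ i → ℚ.toℚᵘ (ι i) ≡ ℚᵘ.mkℚᵘ i 0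
toℚᵘ-ι i rewrite ι≡mkℚ i = refl

ι-homo₂ : (f : ℤ → ℤ → ℤ) (g : ℚ → ℚ → ℚ) (gᵘ : ℚᵘ.ℚᵘ → ℚᵘ.ℚᵘ → ℚᵘ.ℚᵘ) →
          (∀ p q → ℚ.toℚᵘ (g p q) ℚᵘ.≃ gᵘ (ℚ.toℚᵘ p) (ℚ.toℚᵘ q)) →
          (∀ i j → ℚᵘ.mkℚᵘ (f i j) 0 ℚᵘ.≃ gᵘ (ℚᵘ.mkℚᵘ i 0) (ℚᵘ.mkℚᵘ j 0)) →
          ∀ i j → ι (f i j) ≡ g (ι i) (ι j)
ι-homo₂ f g gᵘ homo onFractions i j = ℚP.toℚᵘ-injective (begin
  ℚ.toℚᵘ (ι (f i j))                  ≡⟨ toℚᵘ-ι (f i j) ⟩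
  ℚᵘ.mkℚᵘ (f i j) 0                    ≈⟨ onFractions i j ⟩
  gᵘ (ℚᵘ.mkℚᵘ i 0) (ℚᵘ.mkℚᵘ j 0)      ≡⟨ sym (cong₂ gᵘ (toℚᵘ-ι i) (toℚᵘ-ι j)) ⟩
  gᵘ (ℚ.toℚᵘ (ι i)) (ℚ.toℚᵘ (ι j))    ≈⟨ ℚᵘP.≃-sym (homo (ι i) (ι j)) ⟩
  ℚ.toℚᵘ (g (ι i) (ι j))              ∎)
  where open ℚᵘP.≃-Reasoning

ι-+ : ∀ i j → ι (i ℤ.+ j) ≡ ι i ℚ.+ ι j
ι-+ = ι-homo₂ ℤ._+_ ℚ._+_ ℚᵘ._+_ ℚP.toℚᵘ-homo-+ λ i j →
  ℚᵘ.*≡* (cong (ℤ._* + 1) (sym (cong₂ ℤ._+_ (ℤP.*-identityʳ i) (ℤP.*-identityʳ j))))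

ι-* : ∀ i j → ι (i ℤ.* j) ≡ ι i ℚ.* ι j
ι-* = ι-homo₂ ℤ._*_ ℚ._*_ ℚᵘ._*_ ℚP.toℚᵘ-homo-* λ i j → ℚᵘ.*≡* refl

ι-neg : ∀ i → ι (ℤ.- i) ≡ ℚ.- ι i
ι-neg i = ℚP.toℚᵘ-injective (begin
  ℚ.toℚᵘ (ι (ℤ.- i))       ≡⟨ toℚᵘ-ι (ℤ.- i) ⟩
  ℚᵘ.- ℚᵘ.mkℚᵘ i 0         ≡⟨ cong ℚᵘ.-_ (sym (toℚᵘ-ι i)) ⟩
  ℚᵘ.- ℚ.toℚᵘ (ι i)        ≈⟨ ℚᵘP.≃-sym (ℚP.toℚᵘ-homo‿- (ι i)) ⟩
  ℚ.toℚᵘ (ℚ.- ι i)         ∎)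
  where open ℚᵘP.≃-Reasoning

ι-injective : ∀ {i j} → ι i ≡ ι j → i ≡ j
ι-injective {i} {j} eq =
  trans (sym (cong ℚ.↥_ (ι≡mkℚ i))) (trans (cong ℚ.↥_ eq) (cong ℚ.↥_ (ι≡mkℚ j)))

-- §2  Rational roots of x³ + A x + B are integers.

cubic : ℤ → ℤ → ℤ → ℤ
cubic A B r = r ℤ.* r ℤ.* r ℤ.+ A ℤ.* r ℤ.+ B

-- the same polynomial over ℚ; OnCurve A B (x , y) says exactly y² = cubicℚ A B x
cubicℚ : ℤ → ℤ → ℚ → ℚ
cubicℚ A B x = x ℚ.* x ℚ.* x ℚ.+ ι A ℚ.* x ℚ.+ ι B

ι-cubic : ∀ A B r → ι (cubic A B r) ≡ cubicℚ A B (ι r)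
ι-cubic A B r
  rewrite ι-+ (r ℤ.* r ℤ.* r ℤ.+ A ℤ.* r) B | ι-+ (r ℤ.* r ℤ.* r) (A ℤ.* r)
        | ι-* (r ℤ.* r) r | ι-* r r | ι-* A r = refl

-- the homogenised cubic n³ + A n e² + B e³, whose vanishing clears the denominator e
homogenised : ℤ → ℤ → ℤ → ℤ → ℤ
homogenised A B n e = n ℤ.* n ℤ.* n ℤ.+ A ℤ.* n ℤ.* (e ℤ.* e) ℤ.+ B ℤ.* (e ℤ.* e ℤ.* e)

ι-homogenised : ∀ A B x n e → x ℚ.* ι e ≡ ι n →
  ι (homogenised A B n e) ≡ cubicℚ A B x ℚ.* (ι e ℚ.* ι e ℚ.* ι e)
ι-homogenised A B x n e xe≡n
  rewrite ι-+ (n ℤ.* n ℤ.* n ℤ.+ A ℤ.* n ℤ.* (e ℤ.* e)) (B ℤ.* (e ℤ.* e ℤ.* e))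
        | ι-+ (n ℤ.* n ℤ.* n) (A ℤ.* n ℤ.* (e ℤ.* e))
        | ι-* (n ℤ.* n) n | ι-* n n | ι-* (A ℤ.* n) (e ℤ.* e) | ι-* A n | ι-* e e
        | ι-* B (e ℤ.* e ℤ.* e) | ι-* (e ℤ.* e) e | ι-* e e | sym xe≡n
  = homogenise x (ι A) (ι B) (ι e)
  where
  open ℚ-Solver.+-*-Solver
  homogenise : ∀ x a b e →
    (x ℚ.* e) ℚ.* (x ℚ.* e) ℚ.* (x ℚ.* e) ℚ.+ a ℚ.* (x ℚ.* e) ℚ.* (e ℚ.* e) ℚ.+ b ℚ.* (e ℚ.* e ℚ.* e)
    ≡ (x ℚ.* x ℚ.* x ℚ.+ a ℚ.* x ℚ.+ b) ℚ.* (e ℚ.* e ℚ.* e)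
  homogenise = solve 4 (λ x a b e →
    (x :* e) :* (x :* e) :* (x :* e) :+ a :* (x :* e) :* (e :* e) :+ b :* (e :* e :* e)
    := (x :* x :* x :+ a :* x :+ b) :* (e :* e :* e)) refl

times-denominator : ∀ n d-1 .(c : C.Coprime ∣ n ∣ (suc d-1)) →
  mkℚ n d-1 c ℚ.* ι (+ suc d-1) ≡ ι n
times-denominator n d-1 c = ℚP.toℚᵘ-injective (begin
  ℚ.toℚᵘ (mkℚ n d-1 c ℚ.* ι (+ suc d-1))           ≈⟨ ℚP.toℚᵘ-homo-* (mkℚ n d-1 c) (ι (+ suc d-1)) ⟩
  ℚᵘ.mkℚᵘ n d-1 ℚᵘ.* ℚ.toℚᵘ (ι (+ suc d-1))        ≡⟨ cong (ℚᵘ.mkℚᵘ n d-1 ℚᵘ.*_) (toℚᵘ-ι (+ suc d-1)) ⟩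
  ℚᵘ.mkℚᵘ n d-1 ℚᵘ.* ℚᵘ.mkℚᵘ (+ suc d-1) 0        ≈⟨ ℚᵘ.*≡* cross ⟩
  ℚᵘ.mkℚᵘ n 0                                      ≡⟨ sym (toℚᵘ-ι n) ⟩
  ℚ.toℚᵘ (ι n)                                     ∎)
  where
  open ℚᵘP.≃-Reasoning
  cross : n ℤ.* + suc d-1 ℤ.* + 1 ≡ n ℤ.* + suc (d-1 ℕ.* 1)
  cross = trans (ℤP.*-identityʳ _) (cong (λ k → n ℤ.* + suc k) (sym (ℕP.*-identityʳ d-1)))

clear-denominators : ∀ A B n d-1 .(c : C.Coprime ∣ n ∣ (suc d-1)) →
  cubicℚ A B (mkℚ n d-1 c) ≡ 0ℚ → homogenised A B n (+ suc d-1) ≡ + 0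
clear-denominators A B n d-1 c root = ι-injective (begin
  ι (homogenised A B n (+ suc d-1))                  ≡⟨ ι-homogenised A B (mkℚ n d-1 c) n (+ suc d-1) (times-denominator n d-1 c) ⟩
  cubicℚ A B (mkℚ n d-1 c) ℚ.* D³                    ≡⟨ cong (ℚ._* D³) root ⟩
  0ℚ ℚ.* D³                                          ≡⟨ ℚP.*-zeroˡ D³ ⟩
  0ℚ                                                 ∎)
  where
  open ≡-Reasoning
  D³ = ι (+ suc d-1) ℚ.* ι (+ suc d-1) ℚ.* ι (+ suc d-1)

-- n³ + A n d² + B d³ = 0 means n³ = -(A n d + B d²) · d, so d ∣ ∣ n ∣³
denominator-∣-cube : ∀ A B n d → homogenised A B n (+ d) ≡ + 0 → d ND.∣ ∣ n ∣ * (∣ n ∣ * ∣ n ∣)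
denominator-∣-cube A B n d cleared = ND.divides ∣ k ∣ (begin
  m * (m * m)              ≡⟨ sym (ℕP.*-assoc m m m) ⟩
  m * m * m                ≡⟨ sym (trans (ℤP.abs-* (n ℤ.* n) n) (cong (_* m) (ℤP.abs-* n n))) ⟩
  ∣ n ℤ.* n ℤ.* n ∣        ≡⟨ cong ∣_∣ n³≡kd ⟩
  ∣ k ℤ.* + d ∣            ≡⟨ ℤP.abs-* k (+ d) ⟩
  ∣ k ∣ * d                ∎)
  where
  open ≡-Reasoning
  m = ∣ n ∣
  k = ℤ.- (A ℤ.* n ℤ.* + d ℤ.+ B ℤ.* (+ d ℤ.* + d))
  split : ∀ n A B d → n ℤ.* n ℤ.* n
        ≡ ℤ.- (A ℤ.* n ℤ.* d ℤ.+ B ℤ.* (d ℤ.* d)) ℤ.* d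
          ℤ.+ (n ℤ.* n ℤ.* n ℤ.+ A ℤ.* n ℤ.* (d ℤ.* d) ℤ.+ B ℤ.* (d ℤ.* d ℤ.* d))
  split = ℤ-Ring.solve-∀
  n³≡kd : n ℤ.* n ℤ.* n ≡ k ℤ.* + d
  n³≡kd = trans (split n A B (+ d)) (trans (cong (λ z → k ℤ.* + d ℤ.+ z) cleared) (ℤP.+-identityʳ _))

coprime-divisor-of-cube : ∀ {m d} → C.Coprime m d → d ND.∣ m * (m * m) → d ≡ 1
coprime-divisor-of-cube {m} cop d∣m³ =
  cop (C.coprime-divisor (C.sym cop) (C.coprime-divisor (C.sym cop) d∣m³) , ND.∣-refl)

-- Rational root theorem for the monic cubic x³ + A x + B: the reduced denominator d
-- of a root divides the cube of the numerator, so d = 1.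
integral-root : ∀ A B x → cubicℚ A B x ≡ 0ℚ → Σ ℤ λ r → x ≡ ι r
integral-root A B (mkℚ n d-1 c) root =
  n , denominator-one (ℕP.suc-injective (coprime-divisor-of-cube (C.recompute c)
        (denominator-∣-cube A B n (suc d-1) (clear-denominators A B n d-1 c root))))
  where
  denominator-one : d-1 ≡ 0 → mkℚ n d-1 c ≡ ι n
  denominator-one refl = sym (ι≡mkℚ n)

-- §3  Points of order two are the points (r , 0) with r an integer root, and the
-- chord through two of them is horizontal.

onXAxis : ℚ → Point
onXAxis x = just (x , 0ℚ)

-- the tangent at (x , 0) is vertical, so (x , 0) has order two
double-onXAxis : ∀ A B x → addE A B (onXAxis x) (onXAxis x) ≡ O
double-onXAxis A B x with x ℚP.≟ x
... | no x≢x = ⊥-elim (x≢x refl)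
... | yes _  = refl

horizontal-chord : ∀ l x y → l ≡ 0ℚ →
  _≡_ {A = Point} (just (l ℚ.* l ℚ.- x ℚ.- y , l ℚ.* (x ℚ.- (l ℚ.* l ℚ.- x ℚ.- y)) ℚ.- 0ℚ))
                  (onXAxis (ℚ.- (x ℚ.+ y)))
horizontal-chord l x y refl = cong₂ (λ u v → just (u , v)) (third-x x y) (third-y x y)
  where
  open ℚ-Solver.+-*-Solver
  third-x : ∀ x y → 0ℚ ℚ.* 0ℚ ℚ.- x ℚ.- y ≡ ℚ.- (x ℚ.+ y)
  third-x = solve 2 (λ x y → con 0ℚ :* con 0ℚ :- x :- y := :- (x :+ y)) refl
  third-y : ∀ x y → 0ℚ ℚ.* (x ℚ.- (0ℚ ℚ.* 0ℚ ℚ.- x ℚ.- y)) ℚ.- 0ℚ ≡ 0ℚ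
  third-y = solve 2 (λ x y → con 0ℚ :* (x :- (con 0ℚ :* con 0ℚ :- x :- y)) :- con 0ℚ := con 0ℚ) refl

add-onXAxis : ∀ A B x y → x ≢ y → addE A B (onXAxis x) (onXAxis y) ≡ onXAxis (ℚ.- (x ℚ.+ y))
add-onXAxis A B x y x≢y with x ℚP.≟ y
... | yes x≡y = ⊥-elim (x≢y x≡y)
... | no _ with y ℚ.- x ℚP.≟ 0ℚ
...   | yes _   = horizontal-chord 0ℚ x y refl
...   | no y-x≢0 = horizontal-chord _ x y
                     (ℚP.*-zeroˡ (ℚ.1/_ (y ℚ.- x) {{ℚ.≢-nonZero y-x≢0}}))

-- coordinates of a point, O sent to (0 , 0); used to compare points componentwise
xCoord yCoord : Point → ℚ
xCoord nothing        = 0ℚ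
xCoord (just (x , _)) = x
yCoord nothing        = 0ℚ
yCoord (just (_ , y)) = y

-- P = 2P only for P = O: doubling an affine point either gives O or moves it
double-fixes-only-O : ∀ A B P → P ≡ addE A B P P → P ≡ O
double-fixes-only-O A B nothing _ = refl
double-fixes-only-O A B (just (x , y)) P≡2P with x ℚP.≟ x
... | no x≢x = ⊥-elim (x≢x refl)
... | yes _ with y ℚP.≟ ℚ.- y
...   | yes _    = case P≡2P of λ ()
...   | no y≢-y = ⊥-elim (y≢-y (reflected tangent-slope _ (cong xCoord P≡2P) (cong yCoord P≡2P)))
  where
  tangent-slope = ((ℤ.+ 3 ℚ./ 1) ℚ.* x ℚ.* x ℚ.+ (A ℚ./ 1)) /' ((ℤ.+ 2 ℚ./ 1) ℚ.* y)
  -- doubling gives y-coordinate l (x - x₃) - y, which is -y when x₃ = x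
  reflected : ∀ l x₃ → x ≡ x₃ → y ≡ l ℚ.* (x ℚ.- x₃) ℚ.- y → y ≡ ℚ.- y
  reflected l .x refl y≡ = trans y≡ (vanish l x y)
    where
    open ℚ-Solver.+-*-Solver
    vanish : ∀ l x y → l ℚ.* (x ℚ.- x) ℚ.- y ≡ ℚ.- y
    vanish = solve 3 (λ l x y → l :* (x :- x) :- y := :- y) refl

self-negativeℤ : ∀ i → i ≡ ℤ.- i → i ≡ + 0
self-negativeℤ (+ zero)  _ = refl
self-negativeℤ (+ suc n) ()
self-negativeℤ -[1+ n ]  ()

self-negative : ∀ q → q ≡ ℚ.- q → q ≡ 0ℚ
self-negative q q≡-q =
  ℚP.↥p≡0⇒p≡0 q (self-negativeℤ (ℚ.↥ q) (trans (cong ℚ.↥_ q≡-q) (ℚP.↥-neg q)))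

order-two⇒onXAxis : ∀ A B x y → addE A B (just (x , y)) (just (x , y)) ≡ O → y ≡ 0ℚ
order-two⇒onXAxis A B x y 2P≡O with x ℚP.≟ x
... | no x≢x = ⊥-elim (x≢x refl)
... | yes _ with y ℚP.≟ ℚ.- y
...   | yes y≡-y = self-negative y y≡-y
...   | no _     = case 2P≡O of λ ()

order-two-point : ∀ A B P → OnCurve A B P → addE A B P P ≡ O → P ≢ O →
  Σ ℤ λ r → P ≡ onXAxis (ι r) × cubic A B r ≡ + 0
order-two-point A B nothing _ _ P≢O = ⊥-elim (P≢O refl)
order-two-point A B (just (x , y)) on-curve 2P≡O _ = r , on-axis , ι-injective root
  where
  y≡0 : y ≡ 0ℚ
  y≡0 = order-two⇒onXAxis A B x y 2P≡O
  x-root : cubicℚ A B x ≡ 0ℚ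
  x-root = trans (sym on-curve) (cong (λ z → z ℚ.* z) y≡0)
  r = proj₁ (integral-root A B x x-root)
  x≡r = proj₂ (integral-root A B x x-root)
  on-axis : just (x , y) ≡ onXAxis (ι r)
  on-axis = cong₂ (λ u v → just (u , v)) x≡r y≡0
  root : ι (cubic A B r) ≡ ι (+ 0)
  root = trans (ι-cubic A B r) (trans (cong (cubicℚ A B) (sym x≡r)) x-root)

-- §4  E(ℚ) ⊇ ℤ/2 × ℤ/2 iff x³ + A x + B has three distinct integer roots a, b, -(a + b),
-- i.e. (A , B) = Φ (a , b).

-- the root completing a, b to the roots of a depressed cubic
third : ℤ → ℤ → ℤ
third a b = ℤ.- (a ℤ.+ b)

-- expanding (x - a)(x - b)(x + a + b) = x³ + φA a b · x + φB a b
φA φB : ℤ → ℤ → ℤ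
φA a b = ℤ.- (a ℤ.* a ℤ.+ a ℤ.* b ℤ.+ b ℤ.* b)
φB a b = a ℤ.* b ℤ.* (a ℤ.+ b)

Φ : ℤ × ℤ → ℤ × ℤ
Φ (a , b) = (φA a b , φB a b)

SplitsAt : ℤ → ℤ → ℤ × ℤ → Set
SplitsAt A B (a , b) =
  a ≢ b × a ≢ third a b × b ≢ third a b × A ≡ φA a b × B ≡ φB a b

Split : ℤ → ℤ → Set
Split A B = Σ (ℤ × ℤ) (SplitsAt A B)

cubic-factorisation : ∀ a b t →
  cubic (φA a b) (φB a b) t ≡ (t ℤ.- a) ℤ.* (t ℤ.- b) ℤ.* (t ℤ.- third a b)
cubic-factorisation = factorisation
  where
  factorisation : ∀ a b t →
    t ℤ.* t ℤ.* t ℤ.+ ℤ.- (a ℤ.* a ℤ.+ a ℤ.* b ℤ.+ b ℤ.* b) ℤ.* t ℤ.+ a ℤ.* b ℤ.* (a ℤ.+ b)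
    ≡ (t ℤ.- a) ℤ.* (t ℤ.- b) ℤ.* (t ℤ.- ℤ.- (a ℤ.+ b))
  factorisation = ℤ-Ring.solve-∀

zero-product₃ : ∀ u v w → u ℤ.* v ℤ.* w ≡ + 0 → u ≡ + 0 ⊎ v ≡ + 0 ⊎ w ≡ + 0
zero-product₃ u v w uvw≡0 with ℤP.i*j≡0⇒i≡0∨j≡0 (u ℤ.* v) uvw≡0
... | inj₂ w≡0 = inj₂ (inj₂ w≡0)
... | inj₁ uv≡0 with ℤP.i*j≡0⇒i≡0∨j≡0 u uv≡0
...   | inj₁ u≡0 = inj₁ u≡0
...   | inj₂ v≡0 = inj₂ (inj₁ v≡0)

split-root : ∀ a b t → cubic (φA a b) (φB a b) t ≡ + 0 → t ≡ a ⊎ t ≡ b ⊎ t ≡ third a b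
split-root a b t root with zero-product₃ _ _ _ (trans (sym (cubic-factorisation a b t)) root)
... | inj₁ t-a≡0        = inj₁ (ℤP.i-j≡0⇒i≡j t a t-a≡0)
... | inj₂ (inj₁ t-b≡0) = inj₂ (inj₁ (ℤP.i-j≡0⇒i≡j t b t-b≡0))
... | inj₂ (inj₂ t-c≡0) = inj₂ (inj₂ (ℤP.i-j≡0⇒i≡j t (third a b) t-c≡0))

roots-of-split : ∀ a b → cubic (φA a b) (φB a b) a ≡ + 0
                       × cubic (φA a b) (φB a b) b ≡ + 0
                       × cubic (φA a b) (φB a b) (third a b) ≡ + 0
roots-of-split a b = root-a a b , root-b a b , root-c a b
  where
  root-a : ∀ a b →
    a ℤ.* a ℤ.* a ℤ.+ ℤ.- (a ℤ.* a ℤ.+ a ℤ.* b ℤ.+ b ℤ.* b) ℤ.* a ℤ.+ a ℤ.* b ℤ.* (a ℤ.+ b) ≡ + 0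
  root-a = ℤ-Ring.solve-∀
  root-b : ∀ a b →
    b ℤ.* b ℤ.* b ℤ.+ ℤ.- (a ℤ.* a ℤ.+ a ℤ.* b ℤ.+ b ℤ.* b) ℤ.* b ℤ.+ a ℤ.* b ℤ.* (a ℤ.+ b) ≡ + 0
  root-b = ℤ-Ring.solve-∀
  root-c : ∀ a b → let c = ℤ.- (a ℤ.+ b) in
    c ℤ.* c ℤ.* c ℤ.+ ℤ.- (a ℤ.* a ℤ.+ a ℤ.* b ℤ.+ b ℤ.* b) ℤ.* c ℤ.+ a ℤ.* b ℤ.* (a ℤ.+ b) ≡ + 0
  root-c = ℤ-Ring.solve-∀

third-comm : ∀ a b → third a b ≡ third b a
third-comm a b = cong ℤ.-_ (ℤP.+-comm a b)

third-third : ∀ a b → third a (third a b) ≡ b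
third-third = cancel
  where
  cancel : ∀ a b → ℤ.- (a ℤ.+ ℤ.- (a ℤ.+ b)) ≡ b
  cancel = ℤ-Ring.solve-∀

add-roots : ∀ A B a b c → a ≢ b → c ≡ third a b →
  addE A B (onXAxis (ι a)) (onXAxis (ι b)) ≡ onXAxis (ι c)
add-roots A B a b c a≢b c≡ab = begin
  addE A B (onXAxis (ι a)) (onXAxis (ι b)) ≡⟨ add-onXAxis A B (ι a) (ι b) (a≢b ∘ ι-injective) ⟩
  onXAxis (ℚ.- (ι a ℚ.+ ι b))              ≡⟨ cong onXAxis (cong ℚ.-_ (sym (ι-+ a b))) ⟩
  onXAxis (ℚ.- ι (a ℤ.+ b))                ≡⟨ cong onXAxis (sym (ι-neg (a ℤ.+ b))) ⟩
  onXAxis (ι (third a b))                  ≡⟨ cong (onXAxis ∘ ι) (sym c≡ab) ⟩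
  onXAxis (ι c)                            ∎
  where open ≡-Reasoning

onXAxis-injective : ∀ {r s} → onXAxis (ι r) ≡ onXAxis (ι s) → r ≡ s
onXAxis-injective eq = ι-injective (cong xCoord eq)

twoTorsion : ℤ → ℤ → G → Point
twoTorsion a b (zero , zero)         = O
twoTorsion a b (suc zero , zero)     = onXAxis (ι a)
twoTorsion a b (zero , suc zero)     = onXAxis (ι b)
twoTorsion a b (suc zero , suc zero) = onXAxis (ι (third a b))

root-on-curve : ∀ A B r → cubic A B r ≡ + 0 → OnCurve A B (onXAxis (ι r))
root-on-curve A B r root = sym (trans (sym (ι-cubic A B r)) (cong ι root))

twoTorsion-on-curve : ∀ a b g → OnCurve (φA a b) (φB a b) (twoTorsion a b g)
twoTorsion-on-curve a b (zero , zero)         = _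
twoTorsion-on-curve a b (suc zero , zero)     = root-on-curve (φA a b) (φB a b) a (proj₁ (roots-of-split a b))
twoTorsion-on-curve a b (zero , suc zero)     = root-on-curve (φA a b) (φB a b) b (proj₁ (proj₂ (roots-of-split a b)))
twoTorsion-on-curve a b (suc zero , suc zero) = root-on-curve (φA a b) (φB a b) (third a b) (proj₂ (proj₂ (roots-of-split a b)))

-- for distinct a, b, c = third a b the map is a homomorphism, whatever the curve:
-- each (r , 0) has order two and two of them add up to the third
twoTorsion-homomorphism : ∀ A B a b → a ≢ b → a ≢ third a b → b ≢ third a b → (g h : G) →
  twoTorsion a b (g +G h) ≡ addE A B (twoTorsion a b g) (twoTorsion a b h)
twoTorsion-homomorphism A B a b a≢b a≢c b≢c = homomorphism
  where
  c = third a b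
  homomorphism : (g h : G) → twoTorsion a b (g +G h) ≡ addE A B (twoTorsion a b g) (twoTorsion a b h)
  homomorphism (zero , zero)         h             = refl
  homomorphism (suc zero , zero)     (zero , zero) = refl
  homomorphism (zero , suc zero)     (zero , zero) = refl
  homomorphism (suc zero , suc zero) (zero , zero) = refl
  homomorphism (suc zero , zero)     (suc zero , zero)     = sym (double-onXAxis A B (ι a))
  homomorphism (zero , suc zero)     (zero , suc zero)     = sym (double-onXAxis A B (ι b))
  homomorphism (suc zero , suc zero) (suc zero , suc zero) = sym (double-onXAxis A B (ι c))
  homomorphism (suc zero , zero)     (zero , suc zero)     = sym (add-roots A B a b c a≢b refl)
  homomorphism (suc zero , zero)     (suc zero , suc zero) =
    sym (add-roots A B a c b a≢c (sym (third-third a b)))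
  homomorphism (zero , suc zero)     (suc zero , zero)     =
    sym (add-roots A B b a c (a≢b ∘ sym) (third-comm a b))
  homomorphism (zero , suc zero)     (suc zero , suc zero) =
    sym (add-roots A B b c a b≢c (sym (trans (cong (third b) (third-comm a b)) (third-third b a))))
  homomorphism (suc zero , suc zero) (suc zero , zero)     =
    sym (add-roots A B c a b (a≢c ∘ sym) (sym (trans (third-comm c a) (third-third a b))))
  homomorphism (suc zero , suc zero) (zero , suc zero)     =
    sym (add-roots A B c b a (b≢c ∘ sym)
      (sym (trans (third-comm c b) (trans (cong (third b) (third-comm a b)) (third-third b a)))))

twoTorsion-injective : ∀ a b → a ≢ b → a ≢ third a b → b ≢ third a b → (g h : G) →
  twoTorsion a b g ≡ twoTorsion a b h → g ≡ h
twoTorsion-injective a b a≢b a≢c b≢c = injective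
  where
  injective : (g h : G) → twoTorsion a b g ≡ twoTorsion a b h → g ≡ h
  injective (zero , zero)         (zero , zero)         _ = refl
  injective (suc zero , zero)     (suc zero , zero)     _ = refl
  injective (zero , suc zero)     (zero , suc zero)     _ = refl
  injective (suc zero , suc zero) (suc zero , suc zero) _ = refl
  injective (suc zero , zero)     (zero , suc zero)     eq = ⊥-elim (a≢b (onXAxis-injective eq))
  injective (suc zero , zero)     (suc zero , suc zero) eq = ⊥-elim (a≢c (onXAxis-injective eq))
  injective (zero , suc zero)     (suc zero , zero)     eq = ⊥-elim (a≢b (sym (onXAxis-injective eq)))
  injective (zero , suc zero)     (suc zero , suc zero) eq = ⊥-elim (b≢c (onXAxis-injective eq))
  injective (suc zero , suc zero) (suc zero , zero)     eq = ⊥-elim (a≢c (sym (onXAxis-injective eq)))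
  injective (suc zero , suc zero) (zero , suc zero)     eq = ⊥-elim (b≢c (sym (onXAxis-injective eq)))
  injective (zero , zero)         (suc zero , zero)     ()
  injective (zero , zero)         (zero , suc zero)     ()
  injective (zero , zero)         (suc zero , suc zero) ()
  injective (suc zero , zero)     (zero , zero)         ()
  injective (zero , suc zero)     (zero , zero)         ()
  injective (suc zero , suc zero) (zero , zero)         ()

split⇒subgroup : ∀ A B → Split A B → HasSubgroupG A B
split⇒subgroup _ _ ((a , b) , a≢b , a≢c , b≢c , refl , refl) =
  twoTorsion a b , twoTorsion-on-curve a b ,
  twoTorsion-homomorphism (φA a b) (φB a b) a b a≢b a≢c b≢c , twoTorsion-injective a b a≢b a≢c b≢c

cancel-difference : ∀ u v w → u ≢ v → (u ℤ.- v) ℤ.* w ≡ + 0 → w ≡ + 0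
cancel-difference u v w u≢v eq with ℤP.i*j≡0⇒i≡0∨j≡0 (u ℤ.- v) eq
... | inj₁ u-v≡0 = ⊥-elim (u≢v (ℤP.i-j≡0⇒i≡j u v u-v≡0))
... | inj₂ w≡0   = w≡0

-- (f u - f v) / (u - v) = u² + uv + v² + A for f = x³ + A x + B; it vanishes at distinct roots
pair-relation : ∀ A B u v → u ≢ v → cubic A B u ≡ + 0 → cubic A B v ≡ + 0 →
  u ℤ.* u ℤ.+ u ℤ.* v ℤ.+ v ℤ.* v ℤ.+ A ≡ + 0
pair-relation A B u v u≢v root-u root-v =
  cancel-difference u v _ u≢v (trans (difference u v A B) (cong₂ ℤ._-_ root-u root-v))
  where
  difference : ∀ u v A B → (u ℤ.- v) ℤ.* (u ℤ.* u ℤ.+ u ℤ.* v ℤ.+ v ℤ.* v ℤ.+ A)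
    ≡ (u ℤ.* u ℤ.* u ℤ.+ A ℤ.* u ℤ.+ B) ℤ.- (v ℤ.* v ℤ.* v ℤ.+ A ℤ.* v ℤ.+ B)
  difference = ℤ-Ring.solve-∀

shift-by-zero : ∀ {x y z} → y ≡ x ℤ.+ z → x ≡ + 0 → y ≡ z
shift-by-zero y≡x+z refl = trans y≡x+z (ℤP.+-identityˡ _)

three-roots⇒split : ∀ A B s₁ s₂ s₃ → s₁ ≢ s₂ → s₁ ≢ s₃ → s₂ ≢ s₃ →
  cubic A B s₁ ≡ + 0 → cubic A B s₂ ≡ + 0 → cubic A B s₃ ≡ + 0 → Split A B
three-roots⇒split A B s₁ s₂ s₃ s₁≢s₂ s₁≢s₃ s₂≢s₃ root₁ root₂ root₃ =
  (s₁ , s₂) , s₁≢s₂ , subst (s₁ ≢_) s₃≡ s₁≢s₃ , subst (s₂ ≢_) s₃≡ s₂≢s₃ , A≡ , B≡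
  where
  rel₁₂ = pair-relation A B s₁ s₂ s₁≢s₂ root₁ root₂
  rel₁₃ = pair-relation A B s₁ s₃ s₁≢s₃ root₁ root₃
  -- subtracting the two relations: (s₂ - s₃)(s₁ + s₂ + s₃) = 0
  sum≡0 : s₁ ℤ.+ s₂ ℤ.+ s₃ ≡ + 0
  sum≡0 = cancel-difference s₂ s₃ _ s₂≢s₃ (trans (subtract s₁ s₂ s₃ A) (cong₂ ℤ._-_ rel₁₂ rel₁₃))
    where
    subtract : ∀ s₁ s₂ s₃ A → (s₂ ℤ.- s₃) ℤ.* (s₁ ℤ.+ s₂ ℤ.+ s₃)
      ≡ (s₁ ℤ.* s₁ ℤ.+ s₁ ℤ.* s₂ ℤ.+ s₂ ℤ.* s₂ ℤ.+ A) ℤ.- (s₁ ℤ.* s₁ ℤ.+ s₁ ℤ.* s₃ ℤ.+ s₃ ℤ.* s₃ ℤ.+ A)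
    subtract = ℤ-Ring.solve-∀
  s₃≡ : s₃ ≡ third s₁ s₂
  s₃≡ = shift-by-zero (rearrange s₁ s₂ s₃) sum≡0
    where
    rearrange : ∀ s₁ s₂ s₃ → s₃ ≡ (s₁ ℤ.+ s₂ ℤ.+ s₃) ℤ.+ ℤ.- (s₁ ℤ.+ s₂)
    rearrange = ℤ-Ring.solve-∀
  A≡ : A ≡ φA s₁ s₂
  A≡ = shift-by-zero (rearrange s₁ s₂ A) rel₁₂
    where
    rearrange : ∀ s₁ s₂ A → A ≡ (s₁ ℤ.* s₁ ℤ.+ s₁ ℤ.* s₂ ℤ.+ s₂ ℤ.* s₂ ℤ.+ A)
                             ℤ.+ ℤ.- (s₁ ℤ.* s₁ ℤ.+ s₁ ℤ.* s₂ ℤ.+ s₂ ℤ.* s₂)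
    rearrange = ℤ-Ring.solve-∀
  B≡ : B ≡ φB s₁ s₂
  B≡ = shift-by-zero (rearrange s₁ s₂ A B)
         (trans (cong₂ (λ u v → u ℤ.- s₁ ℤ.* v) root₁ rel₁₂) (cong (λ z → + 0 ℤ.- z) (ℤP.*-zeroʳ s₁)))
    where
    rearrange : ∀ s₁ s₂ A B → B ≡ ((s₁ ℤ.* s₁ ℤ.* s₁ ℤ.+ A ℤ.* s₁ ℤ.+ B)
        ℤ.- s₁ ℤ.* (s₁ ℤ.* s₁ ℤ.+ s₁ ℤ.* s₂ ℤ.+ s₂ ℤ.* s₂ ℤ.+ A)) ℤ.+ s₁ ℤ.* s₂ ℤ.* (s₁ ℤ.+ s₂)
    rearrange = ℤ-Ring.solve-∀

-- A subgroup ℤ/2 × ℤ/2 consists of O and three points of order two, whose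
-- x-coordinates are three distinct integer roots.
subgroup⇒split : ∀ A B → HasSubgroupG A B → Split A B
subgroup⇒split A B (f , on-curve , homomorphism , injective) =
  three-roots⇒split A B r₁ r₂ r₃ (distinct p₁ p₂ (λ ())) (distinct p₁ p₃ (λ ())) (distinct p₂ p₃ (λ ()))
    (root p₁) (root p₂) (root p₃)
  where
  e : G
  e = (zero , zero)
  f-e : f e ≡ O
  f-e = double-fixes-only-O A B (f e) (homomorphism e e)
  RootPoint : G → Set
  RootPoint g = Σ ℤ λ r → f g ≡ onXAxis (ι r) × cubic A B r ≡ + 0
  -- each non-identity g has g + g = e, so f g is a point of order two
  order-two : (g : G) → g +G g ≡ e → g ≢ e → RootPoint g
  order-two g g+g≡e g≢e = order-two-point A B (f g) (on-curve g)
    (trans (sym (homomorphism g g)) (trans (cong f g+g≡e) f-e))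
    (λ fg≡O → g≢e (injective g e (trans fg≡O (sym f-e))))
  p₁ = order-two (suc zero , zero) refl (λ ())
  p₂ = order-two (zero , suc zero) refl (λ ())
  p₃ = order-two (suc zero , suc zero) refl (λ ())
  r₁ = proj₁ p₁
  r₂ = proj₁ p₂
  r₃ = proj₁ p₃
  root : ∀ {g} (p : RootPoint g) → cubic A B (proj₁ p) ≡ + 0
  root (_ , _ , root-r) = root-r
  distinct : ∀ {g h} (p : RootPoint g) (q : RootPoint h) → g ≢ h → proj₁ p ≢ proj₁ q
  distinct {g} {h} (r , fg≡ , _) (s , fh≡ , _) g≢h r≡s =
    g≢h (injective g h (trans fg≡ (trans (cong (onXAxis ∘ ι) r≡s) (sym fh≡))))

-- The discriminant of a split cubic is minus a nonzero square:
-- 4 φA³ + 27 φB² = -((a - b)(a - c)(b - c))².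
split⇒nonsingular : ∀ A B → Split A B → NonSingular A B
split⇒nonsingular _ _ ((a , b) , a≢b , a≢c , b≢c , refl , refl) disc≡0 =
  D²≢0 (trans (sym (discriminant a b)) (cong ℤ.-_ disc≡0))
  where
  c = third a b
  D = (a ℤ.- b) ℤ.* (a ℤ.- c) ℤ.* (b ℤ.- c)
  discriminant : ∀ a b → let c = ℤ.- (a ℤ.+ b) in
    ℤ.- (+ 4 ℤ.* (ℤ.- (a ℤ.* a ℤ.+ a ℤ.* b ℤ.+ b ℤ.* b) ℤ.* ℤ.- (a ℤ.* a ℤ.+ a ℤ.* b ℤ.+ b ℤ.* b)
                    ℤ.* ℤ.- (a ℤ.* a ℤ.+ a ℤ.* b ℤ.+ b ℤ.* b))
         ℤ.+ + 27 ℤ.* (a ℤ.* b ℤ.* (a ℤ.+ b) ℤ.* (a ℤ.* b ℤ.* (a ℤ.+ b))))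
    ≡ ((a ℤ.- b) ℤ.* (a ℤ.- c) ℤ.* (b ℤ.- c)) ℤ.* ((a ℤ.- b) ℤ.* (a ℤ.- c) ℤ.* (b ℤ.- c))
  discriminant = ℤ-Ring.solve-∀
  difference≢0 : ∀ {u v} → u ≢ v → u ℤ.- v ≢ + 0
  difference≢0 u≢v u-v≡0 = u≢v (ℤP.i-j≡0⇒i≡j _ _ u-v≡0)
  D≢0 : D ≢ + 0
  D≢0 D≡0 with zero-product₃ _ _ _ D≡0
  ... | inj₁ eq        = difference≢0 a≢b eq
  ... | inj₂ (inj₁ eq) = difference≢0 a≢c eq
  ... | inj₂ (inj₂ eq) = difference≢0 b≢c eq
  D²≢0 : D ℤ.* D ≢ + 0
  D²≢0 D²≡0 with ℤP.i*j≡0⇒i≡0∨j≡0 D D²≡0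
  ... | inj₁ eq = D≢0 eq
  ... | inj₂ eq = D≢0 eq

-- §5  The roots are bounded by the coefficients: 3 a² ≤ 4 ∣ A ∣.

square-abs : ∀ i → i ℤ.* i ≡ + (∣ i ∣ * ∣ i ∣)
square-abs (+ n)    = ℤP.+◃n≡+n (n * n)
square-abs -[1+ n ] = refl

-- 4 (a² + ab + b²) = 3a² + (a + 2b)², so a root a is bounded by the coefficient A
root-bound : ∀ a b → 3 * (∣ a ∣ * ∣ a ∣) ≤ 4 * ∣ φA a b ∣
root-bound a b = subst (3 * (m * m) ≤_) sum-of-squares (ℕP.m≤m+n (3 * (m * m)) (t * t))
  where
  m = ∣ a ∣
  s = a ℤ.+ + 2 ℤ.* b
  t = ∣ s ∣
  Q = a ℤ.* a ℤ.+ a ℤ.* b ℤ.+ b ℤ.* b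
  completing-square : ∀ a b → + 4 ℤ.* (a ℤ.* a ℤ.+ a ℤ.* b ℤ.+ b ℤ.* b)
    ≡ + 3 ℤ.* (a ℤ.* a) ℤ.+ (a ℤ.+ + 2 ℤ.* b) ℤ.* (a ℤ.+ + 2 ℤ.* b)
  completing-square = ℤ-Ring.solve-∀
  in-ℕ : + 4 ℤ.* Q ≡ + (3 * (m * m) + t * t)
  in-ℕ = trans (completing-square a b)
    (cong₂ ℤ._+_ (trans (cong (+ 3 ℤ.*_) (square-abs a)) (ℤP.+◃n≡+n (3 * (m * m)))) (square-abs s))
  sum-of-squares : 3 * (m * m) + t * t ≡ 4 * ∣ φA a b ∣
  sum-of-squares = begin
    3 * (m * m) + t * t       ≡⟨ cong ∣_∣ (sym in-ℕ) ⟩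
    ∣ + 4 ℤ.* Q ∣             ≡⟨ ℤP.abs-* (+ 4) Q ⟩
    4 * ∣ Q ∣                 ≡⟨ cong (4 *_) (sym (ℤP.∣-i∣≡∣i∣ Q)) ⟩
    4 * ∣ φA a b ∣            ∎
    where open ≡-Reasoning

-- φA is symmetric, so the bound applies to both roots
φA-comm : ∀ a b → φA a b ≡ φA b a
φA-comm = symmetric
  where
  symmetric : ∀ a b → ℤ.- (a ℤ.* a ℤ.+ a ℤ.* b ℤ.+ b ℤ.* b) ≡ ℤ.- (b ℤ.* b ℤ.+ b ℤ.* a ℤ.+ a ℤ.* a)
  symmetric = ℤ-Ring.solve-∀

roots-bound : ∀ A a b → A ≡ φA a b → 3 * (∣ a ∣ * ∣ a ∣) ≤ 4 * ∣ A ∣ × 3 * (∣ b ∣ * ∣ b ∣) ≤ 4 * ∣ A ∣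
roots-bound _ a b refl = root-bound a b , subst (λ A → 3 * (∣ b ∣ * ∣ b ∣) ≤ 4 * ∣ A ∣) (φA-comm b a) (root-bound b a)

-- §6  Counting with duplicate-free lists: pigeonhole, injections, maximal elements.

module _ {A : Set} where

  ∈-─ : ∀ {x z : A} {ys : List A} (x∈ys : x ∈ ys) → z ∈ ys → z ≢ x → z ∈ (ys ─ x∈ys)
  ∈-─ (here refl) (here z≡x)  z≢x = ⊥-elim (z≢x z≡x)
  ∈-─ (here refl) (there z∈ys) _   = z∈ys
  ∈-─ (there _)   (here z≡y)  _   = here z≡y
  ∈-─ (there x∈ys) (there z∈ys) z≢x = there (∈-─ x∈ys z∈ys z≢x)

  unique⊆⇒length≤ : ∀ (xs ys : List A) → Unique xs → (∀ {z} → z ∈ xs → z ∈ ys) →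
                     length xs ≤ length ys
  unique⊆⇒length≤ []       ys _              _ = z≤n
  unique⊆⇒length≤ (x ∷ xs) ys (x∉xs ∷ uniq) xs⊆ys = begin
    suc (length xs)               ≤⟨ s≤s (unique⊆⇒length≤ xs (ys ─ x∈ys) uniq rest⊆) ⟩
    suc (length (ys ─ x∈ys))      ≡⟨ sym (LP.length-removeAt′ ys (index x∈ys)) ⟩
    length ys                     ∎
    where
    open ℕP.≤-Reasoning
    x∈ys = xs⊆ys (here refl)
    rest⊆ : ∀ {z} → z ∈ xs → z ∈ (ys ─ x∈ys)
    rest⊆ z∈xs = ∈-─ x∈ys (xs⊆ys (there z∈xs)) (λ z≡x → All.lookup x∉xs z∈xs (sym z≡x))

module _ {A B : Set} where

  InjectiveOn : (A → B) → List A → Set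
  InjectiveOn f xs = ∀ {x y} → x ∈ xs → y ∈ xs → f x ≡ f y → x ≡ y

  unique-map : ∀ (f : A → B) (xs : List A) → Unique xs → InjectiveOn f xs → Unique (map f xs)
  unique-map f []       _              _   = []
  unique-map f (x ∷ xs) (x∉xs ∷ uniq) inj =
    AllP.map⁺ (All.tabulate λ y∈xs fx≡fy → All.lookup x∉xs y∈xs (inj (here refl) (there y∈xs) fx≡fy))
    ∷ unique-map f xs uniq (λ p q → inj (there p) (there q))

  injection⇒length≤ : ∀ (f : A → B) (xs : List A) (ys : List B) → Unique xs → InjectiveOn f xs →
                      (∀ {x} → x ∈ xs → f x ∈ ys) → length xs ≤ length ys
  injection⇒length≤ f xs ys uniq inj maps-into =
    subst (_≤ length ys) (LP.length-map f xs)
      (unique⊆⇒length≤ (map f xs) ys (unique-map f xs uniq inj) image⊆)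
    where
    image⊆ : ∀ {z} → z ∈ map f xs → z ∈ ys
    image⊆ z∈image with MP.∈-map⁻ f z∈image
    ... | x , x∈xs , refl = maps-into x∈xs

  length-cartesianProduct : ∀ (xs : List A) (ys : List B) →
                            length (cartesianProduct xs ys) ≡ length xs * length ys
  length-cartesianProduct []       ys = refl
  length-cartesianProduct (x ∷ xs) ys =
    trans (LP.length-++ (map (x ,_) ys))
          (cong₂ _+_ (LP.length-map (x ,_) ys) (length-cartesianProduct xs ys))

largest : (P : ℕ → Set) → (∀ n → Dec (P n)) → P 0 → (B : ℕ) →
          Σ ℕ λ m → m ≤ B × P m × (∀ k → k ≤ B → P k → k ≤ m)
largest P P? P0 zero = 0 , z≤n , P0 , λ { zero _ _ → z≤n ; (suc k) () _ }
largest P P? P0 (suc B) with P? (suc B)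
... | yes PB = suc B , ℕP.≤-refl , PB , λ k k≤B _ → k≤B
... | no ¬PB with largest P P? P0 B
...   | m , m≤B , Pm , maximal = m , ℕP.m≤n⇒m≤1+n m≤B , Pm , maximal′
  where
  maximal′ : ∀ k → k ≤ suc B → P k → k ≤ m
  maximal′ k k≤1+B Pk with k ℕP.≟ suc B
  ... | yes refl = ⊥-elim (¬PB Pk)
  ... | no k≢1+B = maximal k (ℕP.≤-pred (ℕP.≤∧≢⇒< k≤1+B k≢1+B)) Pk

-- §7  Finite boxes of integers, searched and counted below.

interval : ℕ → List ℤ
interval K = map +_ (upTo (suc K)) ++ map -[1+_] (upTo K)

∈-interval : ∀ {K} z → ∣ z ∣ ≤ K → z ∈ interval K
∈-interval {K} (+ n)    n≤K = MP.∈-++⁺ˡ (MP.∈-map⁺ +_ (MP.∈-upTo⁺ (s≤s n≤K)))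
∈-interval {K} -[1+ n ] n<K = MP.∈-++⁺ʳ (map +_ (upTo (suc K))) (MP.∈-map⁺ -[1+_] (MP.∈-upTo⁺ n<K))

interval-unique : ∀ K → Unique (interval K)
interval-unique K =
  UP.++⁺ (UP.map⁺ ℤP.+-injective (UP.upTo⁺ (suc K))) (UP.map⁺ ℤP.-[1+-injective (UP.upTo⁺ K)) disjoint
  where
  disjoint : ∀ {z} → z ∈ map +_ (upTo (suc K)) × z ∈ map -[1+_] (upTo K) → ⊥
  disjoint (z∈⁺ , z∈⁻) with MP.∈-map⁻ +_ z∈⁺ | MP.∈-map⁻ -[1+_] z∈⁻
  ... | _ , _ , refl | _ , _ , ()

length-interval : ∀ K → length (interval K) ≡ suc K + K
length-interval K = trans (LP.length-++ (map +_ (upTo (suc K))))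
  (cong₂ _+_ (trans (LP.length-map +_ (upTo (suc K))) (LP.length-upTo (suc K)))
             (trans (LP.length-map -[1+_] (upTo K)) (LP.length-upTo K)))

box : ℕ → List (ℤ × ℤ)
box K = cartesianProduct (interval K) (interval K)

∈-box : ∀ {K} a b → ∣ a ∣ ≤ K → ∣ b ∣ ≤ K → (a , b) ∈ box K
∈-box a b a≤K b≤K = MP.∈-cartesianProduct⁺ (∈-interval a a≤K) (∈-interval b b≤K)

box-unique : ∀ K → Unique (box K)
box-unique K = UP.cartesianProduct⁺ (interval-unique K) (interval-unique K)

length-box : ∀ K → length (box K) ≡ (suc K + K) * (suc K + K)
length-box K = trans (length-cartesianProduct (interval K) (interval K))
                     (cong₂ _*_ (length-interval K) (length-interval K))

-- §8  CountedG X is decidable: the roots of a split cubic lie in a box of radius 4 ∣ A ∣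
-- and d¹² ∣ g ≠ 0 forces d ≤ g.

splitsAt? : ∀ A B ab → Dec (SplitsAt A B ab)
splitsAt? A B (a , b) =
  ¬? (a ℤ.≟ b) ×-dec ¬? (a ℤ.≟ third a b) ×-dec ¬? (b ℤ.≟ third a b)
  ×-dec (A ℤ.≟ φA a b) ×-dec (B ℤ.≟ φB a b)

m≤m^[1+k] : ∀ m k → m ≤ m ^ suc k
m≤m^[1+k] zero    k = z≤n
m≤m^[1+k] (suc m) k =
  subst (_≤ suc m ^ suc k) (ℕP.*-identityʳ (suc m)) (ℕP.^-monoʳ-≤ (suc m) {1} {suc k} (s≤s z≤n))

m≤3m² : ∀ m → m ≤ 3 * (m * m)
m≤3m² zero    = z≤n
m≤3m² (suc k) = ℕP.≤-trans (ℕP.m≤m*n (suc k) (suc k)) (ℕP.m≤n*m (suc k * suc k) 3)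

split⇒∈box : ∀ A B a b → SplitsAt A B (a , b) → (a , b) ∈ box (4 * ∣ A ∣)
split⇒∈box A B a b (_ , _ , _ , A≡ , _) with roots-bound A a b A≡
... | 3a²≤4A , 3b²≤4A = ∈-box a b (ℕP.≤-trans (m≤3m² ∣ a ∣) 3a²≤4A) (ℕP.≤-trans (m≤3m² ∣ b ∣) 3b²≤4A)

split? : ∀ A B → Dec (Split A B)
split? A B with any? (splitsAt? A B) (box (4 * ∣ A ∣))
... | yes found = yes (satisfied found)
... | no none   = no λ { ((a , b) , s) → none (lose (split⇒∈box A B a b s) s) }

hasSubgroupG? : ∀ A B → Dec (HasSubgroupG A B)
hasSubgroupG? A B = map′ (split⇒subgroup A B) (subgroup⇒split A B) (split? A B)

d≤d^12 : ∀ d → d ≤ d ^ 12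
d≤d^12 d = m≤m^[1+k] d 11

-- g ≠ 0 is twelfth-power free iff no d ≤ g is a witness, since d ≤ d¹² ≤ g
twelfth-power-free? : ∀ g → Dec (∀ d → 2 ≤ d → ¬ ((d ^ 12) ND.∣ g))
twelfth-power-free? zero = no (λ free → free 2 (s≤s (s≤s z≤n)) (ND._∣0 (2 ^ 12)))
twelfth-power-free? g@(suc _) with ℕP.allUpTo? (λ d → (2 ℕP.≤? d) →-dec ¬? ((d ^ 12) ND.∣? g)) (suc g)
... | no  ¬small = no λ free → ¬small λ {d} _ → free d
... | yes small  = yes free
  where
  free : ∀ d → 2 ≤ d → ¬ ((d ^ 12) ND.∣ g)
  free d 2≤d d¹²∣g = small (s≤s (ℕP.≤-trans (d≤d^12 d) (ND.∣⇒≤ d¹²∣g))) 2≤d d¹²∣g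

minimal? : ∀ A B → Dec (Minimal A B)
minimal? A B = twelfth-power-free? (GCD.gcd (∣ A ∣ ^ 3) (∣ B ∣ ^ 2))

nonSingular? : ∀ A B → Dec (NonSingular A B)
nonSingular? A B = ¬? (_ ℤ.≟ + 0)

counted? : ∀ X AB → Dec (CountedG X AB)
counted? X (A , B) =
  nonSingular? A B ×-dec minimal? A B ×-dec (height A B ℕP.≤? X) ×-dec hasSubgroupG? A B

-- §9  The counted curves lie in the box ∣ A ∣, ∣ B ∣ ≤ X, so filtering it gives N'_G(X).

height-bounds : ∀ X A B → height A B ≤ X → ∣ A ∣ ^ 3 ≤ X × ∣ B ∣ ^ 2 ≤ X
height-bounds X A B h≤X =
  ℕP.≤-trans (ℕP.m≤m⊔n (∣ A ∣ ^ 3) (∣ B ∣ ^ 2)) h≤X , ℕP.≤-trans (ℕP.m≤n⊔m (∣ A ∣ ^ 3) (∣ B ∣ ^ 2)) h≤X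

counted : ℕ → List (ℤ × ℤ)
counted X = filter (counted? X) (box X)

counted-unique : ∀ X → Unique (counted X)
counted-unique X = UP.filter⁺ (counted? X) (box-unique X)

counted-sound : ∀ X {AB} → AB ∈ counted X → CountedG X AB
counted-sound X AB∈ = proj₂ (MP.∈-filter⁻ (counted? X) {xs = box X} AB∈)

counted-complete : ∀ X AB → CountedG X AB → AB ∈ counted X
counted-complete X (A , B) c@(_ , _ , h≤X , _) with height-bounds X A B h≤X
... | A³≤X , B²≤X = MP.∈-filter⁺ (counted? X)
  (∈-box A B (ℕP.≤-trans (m≤m^[1+k] ∣ A ∣ 2) A³≤X) (ℕP.≤-trans (m≤m^[1+k] ∣ B ∣ 1) B²≤X)) c

counted-isCount : ∀ X → IsCount (CountedG X) (length (counted X))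
counted-isCount X = counted X , counted-unique X , (λ AB → counted-sound X , counted-complete X AB) , refl

-- §10  Upper bound N'_G(X)³ ≤ 3⁷ X: counted curves are images under Φ of a box of
-- radius R with R⁶ ≤ 3 X.

-- a root m of a curve with ∣ A ∣³ ≤ X satisfies m⁶ ≤ 3 X, since 27 m⁶ ≤ 64 ∣ A ∣³
root⁶-bound : ∀ X A m → ∣ A ∣ ^ 3 ≤ X → 3 * (m * m) ≤ 4 * ∣ A ∣ → m ^ 6 ≤ 3 * X
root⁶-bound X A m A³≤X 3m²≤4A = ℕP.*-cancelˡ-≤ 27 (begin
  27 * m ^ 6            ≡⟨ cube-of-3m² m ⟩
  (3 * (m * m)) ^ 3     ≤⟨ ℕP.^-monoˡ-≤ 3 3m²≤4A ⟩
  (4 * ∣ A ∣) ^ 3        ≡⟨ cube-of-4a ∣ A ∣ ⟩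
  64 * ∣ A ∣ ^ 3         ≤⟨ ℕP.*-monoʳ-≤ 64 A³≤X ⟩
  64 * X                ≤⟨ ℕP.*-monoˡ-≤ X {64} {81} (ℕP.m≤m+n 64 17) ⟩
  81 * X                ≡⟨ ℕP.*-assoc 27 3 X ⟩
  27 * (3 * X)          ∎)
  where
  open ℕP.≤-Reasoning
  open ℕ-Solver.+-*-Solver
  cube-of-3m² : ∀ m → 27 * m ^ 6 ≡ (3 * (m * m)) ^ 3
  cube-of-3m² = solve 1 (λ m → con 27 :* (m :^ 6) := (con 3 :* (m :* m)) :^ 3) refl
  cube-of-4a : ∀ a → (4 * a) ^ 3 ≡ 64 * a ^ 3
  cube-of-4a = solve 1 (λ a → (con 4 :* a) :^ 3 := con 64 :* (a :^ 3)) refl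

-- the box of radius R has (2R + 1)² elements, and ((2R + 1)²)³ ≤ 3⁶ R⁶ ≤ 3⁷ X
box-size-bound : ∀ X → 1 ≤ X → ∀ R → R ^ 6 ≤ 3 * X → ((suc R + R) * (suc R + R)) ^ 3 ≤ 2187 * X
box-size-bound X 1≤X zero      _    = ℕP.≤-trans 1≤X (ℕP.m≤n*m X 2187)
box-size-bound X 1≤X R@(suc _) R⁶≤3X = begin
  (w * w) ^ 3            ≤⟨ ℕP.^-monoˡ-≤ 3 (ℕP.*-mono-≤ w≤3R w≤3R) ⟩
  (3 * R * (3 * R)) ^ 3  ≡⟨ expand R ⟩
  729 * R ^ 6            ≤⟨ ℕP.*-monoʳ-≤ 729 R⁶≤3X ⟩
  729 * (3 * X)          ≡⟨ sym (ℕP.*-assoc 729 3 X) ⟩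
  2187 * X               ∎
  where
  open ℕP.≤-Reasoning
  open ℕ-Solver.+-*-Solver
  w = suc R + R
  w≤3R : w ≤ 3 * R
  w≤3R = begin
    suc R + R          ≤⟨ ℕP.+-monoˡ-≤ R (ℕP.+-monoˡ-≤ R (s≤s z≤n)) ⟩
    R + R + R          ≡⟨ solve 1 (λ R → R :+ R :+ R := con 3 :* R) refl R ⟩
    3 * R              ∎
  expand : ∀ R → (3 * R * (3 * R)) ^ 3 ≡ 729 * R ^ 6
  expand = solve 1 (λ R → (con 3 :* R :* (con 3 :* R)) :^ 3 := con 729 :* (R :^ 6)) refl

-- With R maximal among R⁶ ≤ 3 X, every counted curve is Φ of a pair in box R.
upper-bound : ∀ X → 1 ≤ X → length (counted X) ^ 3 ≤ 2187 * X
upper-bound X 1≤X = ℕP.≤-trans (ℕP.^-monoˡ-≤ 3 count≤) (box-size-bound X 1≤X R R⁶≤3X)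
  where
  R-maximal = largest (λ m → m ^ 6 ≤ 3 * X) (λ m → (m ^ 6) ℕP.≤? (3 * X)) z≤n (3 * X)
  R = proj₁ R-maximal
  R⁶≤3X : R ^ 6 ≤ 3 * X
  R⁶≤3X = proj₁ (proj₂ (proj₂ R-maximal))
  root≤R : ∀ A m → ∣ A ∣ ^ 3 ≤ X → 3 * (m * m) ≤ 4 * ∣ A ∣ → m ≤ R
  root≤R A m A³≤X 3m²≤4A = proj₂ (proj₂ (proj₂ R-maximal)) m
    (ℕP.≤-trans (m≤m^[1+k] m 5) m⁶≤3X) m⁶≤3X
    where m⁶≤3X = root⁶-bound X A m A³≤X 3m²≤4A
  split-∈-image : ∀ {A B} → ∣ A ∣ ^ 3 ≤ X → Split A B → (A , B) ∈ map Φ (box R)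
  split-∈-image {A} {B} A³≤X ((a , b) , _ , _ , _ , A≡ , B≡) with roots-bound A a b A≡
  ... | 3a²≤4A , 3b²≤4A = subst (_∈ map Φ (box R)) (cong₂ _,_ (sym A≡) (sym B≡))
    (MP.∈-map⁺ Φ (∈-box a b (root≤R A ∣ a ∣ A³≤X 3a²≤4A) (root≤R A ∣ b ∣ A³≤X 3b²≤4A)))
  counted⊆image : ∀ {AB} → AB ∈ counted X → AB ∈ map Φ (box R)
  counted⊆image {A , B} AB∈ with counted-sound X AB∈
  ... | _ , _ , h≤X , subgroup =
    split-∈-image (proj₁ (height-bounds X A B h≤X)) (subgroup⇒split A B subgroup)
  count≤ : length (counted X) ≤ (suc R + R) * (suc R + R)
  count≤ = begin
    length (counted X)        ≤⟨ unique⊆⇒length≤ (counted X) (map Φ (box R)) (counted-unique X) counted⊆image ⟩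
    length (map Φ (box R))    ≡⟨ LP.length-map Φ (box R) ⟩
    length (box R)            ≡⟨ length-box R ⟩
    (suc R + R) * (suc R + R) ∎
    where open ℕP.≤-Reasoning

-- §11  At least a quarter of the pairs in [1 , N]² are coprime: the others are covered
-- by the sets d · [1 , N / d]², d ≥ 2, of total size Σ (N / d)² ≤ ¾ N².

range : ℕ → List ℕ
range N = map suc (upTo N)

∈-range : ∀ {N u} → 1 ≤ u → u ≤ N → u ∈ range N
∈-range {N} {suc u} _ u<N = MP.∈-map⁺ suc (MP.∈-upTo⁺ u<N)

∈-range⁻ : ∀ {N u} → u ∈ range N → 1 ≤ u × u ≤ N
∈-range⁻ {N} u∈ with MP.∈-map⁻ suc u∈
... | v , v∈ , refl = s≤s z≤n , MP.∈-upTo⁻ v∈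

square : ℕ → List (ℕ × ℕ)
square N = cartesianProduct (range N) (range N)

∈-square⁻ : ∀ {N a c} → (a , c) ∈ square N → (1 ≤ a × a ≤ N) × (1 ≤ c × c ≤ N)
∈-square⁻ {N} ac∈ with MP.∈-cartesianProduct⁻ (range N) (range N) ac∈
... | a∈ , c∈ = ∈-range⁻ a∈ , ∈-range⁻ c∈

square-unique : ∀ N → Unique (square N)
square-unique N = UP.cartesianProduct⁺ range-unique range-unique
  where range-unique = UP.map⁺ ℕP.suc-injective (UP.upTo⁺ N)

length-square : ∀ N → length (square N) ≡ N * N
length-square N = trans (length-cartesianProduct (range N) (range N)) (cong₂ _*_ length-range length-range)
  where length-range = trans (LP.length-map suc (upTo N)) (LP.length-upTo N)

multiples : (N d : ℕ) .{{_ : ℕ.NonZero d}} → List (ℕ × ℕ)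
multiples N d = map (λ (u , v) → (d * u , d * v)) (square (N / d))

-- the pairs in [1 , N]² with a common divisor 2 ≤ d ≤ k + 1 (with repetitions)
cover : ℕ → ℕ → List (ℕ × ℕ)
cover N zero    = []
cover N (suc k) = cover N k ++ multiples N (2 + k)

∈-cover : ∀ N k e {x} → e < k → x ∈ multiples N (2 + e) → x ∈ cover N k
∈-cover N (suc k) e e<1+k x∈ with e ℕP.≟ k
... | yes refl = MP.∈-++⁺ʳ (cover N e) x∈
... | no  e≢k  = MP.∈-++⁺ˡ (∈-cover N k e (ℕP.≤∧≢⇒< (ℕP.≤-pred e<1+k) e≢k) x∈)

Σ< : (ℕ → ℕ) → ℕ → ℕ
Σ< f zero    = 0
Σ< f (suc k) = Σ< f k + f k

length-cover : ∀ N k → length (cover N k) ≡ Σ< (λ e → (N / (2 + e)) * (N / (2 + e))) k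
length-cover N zero    = refl
length-cover N (suc k) = trans (LP.length-++ (cover N k))
  (cong₂ _+_ (length-cover N k)
             (trans (LP.length-map _ (square (N / (2 + k)))) (length-square (N / (2 + k)))))

-- one telescoping step, from y² ≤ N² / (K (K + 1)) = N² (1/K - 1/(K+1)):
-- S ≤ (3/4 - 1/K) N² and (K + 1) y ≤ N give S + y² ≤ (3/4 - 1/(K+1)) N²
telescoping-step : ∀ N K S y → 1 ≤ K → y * suc K ≤ N →
  4 * K * S + 4 * (N * N) ≤ 3 * K * (N * N) →
  4 * suc K * (S + y * y) + 4 * (N * N) ≤ 3 * suc K * (N * N)
telescoping-step N K S y 1≤K y[K+1]≤N hyp =
  ℕP.*-cancelˡ-≤ K {{ℕ.>-nonZero 1≤K}} (ℕP.+-cancelʳ-≤ (4 * suc K * (N * N)) _ _ scaled)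
  where
  open ℕP.≤-Reasoning
  y²-bound : K * suc K * (y * y) ≤ N * N
  y²-bound = begin
    K * suc K * (y * y)         ≤⟨ ℕP.*-monoˡ-≤ (y * y) (ℕP.*-monoˡ-≤ (suc K) (ℕP.n≤1+n K)) ⟩
    suc K * suc K * (y * y)     ≡⟨ regroup (suc K) y ⟩
    (y * suc K) * (y * suc K)   ≤⟨ ℕP.*-mono-≤ y[K+1]≤N y[K+1]≤N ⟩
    N * N                       ∎
    where
    regroup : ∀ k y → k * k * (y * y) ≡ (y * k) * (y * k)
    regroup = ℕ-Ring.solve-∀
  expand : ∀ N K S y → K * (4 * (1 + K) * (S + y * y) + 4 * (N * N)) + 4 * (1 + K) * (N * N)
    ≡ (1 + K) * (4 * K * S + 4 * (N * N)) + 4 * (K * (1 + K) * (y * y)) + 4 * K * (N * N)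
  expand = ℕ-Ring.solve-∀
  collect : ∀ N K → (1 + K) * (3 * K * (N * N)) + 4 * (N * N) + 4 * K * (N * N)
    ≡ K * (3 * (1 + K) * (N * N)) + 4 * (1 + K) * (N * N)
  collect = ℕ-Ring.solve-∀
  scaled : K * (4 * suc K * (S + y * y) + 4 * (N * N)) + 4 * suc K * (N * N)
         ≤ K * (3 * suc K * (N * N)) + 4 * suc K * (N * N)
  scaled = begin
    K * (4 * suc K * (S + y * y) + 4 * (N * N)) + 4 * suc K * (N * N)
      ≡⟨ expand N K S y ⟩
    suc K * (4 * K * S + 4 * (N * N)) + 4 * (K * suc K * (y * y)) + 4 * K * (N * N)
      ≤⟨ ℕP.+-monoˡ-≤ (4 * K * (N * N)) (ℕP.+-mono-≤ (ℕP.*-monoʳ-≤ (suc K) hyp) (ℕP.*-monoʳ-≤ 4 y²-bound)) ⟩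
    suc K * (3 * K * (N * N)) + 4 * (N * N) + 4 * K * (N * N)
      ≡⟨ collect N K ⟩
    K * (3 * suc K * (N * N)) + 4 * suc K * (N * N) ∎

-- Σ_{d=2}^{j+2} y_d² ≤ (3/4 - 1/(j+2)) N² whenever d · y_d ≤ N (indexing y by e = d - 2)
square-sum-bound : ∀ N (y : ℕ → ℕ) → (∀ e → y e * (2 + e) ≤ N) → ∀ j →
  4 * (2 + j) * Σ< (λ e → y e * y e) (suc j) + 4 * (N * N) ≤ 3 * (2 + j) * (N * N)
square-sum-bound N y dy≤N zero = begin
  4 * 2 * (0 + y 0 * y 0) + 4 * (N * N)       ≡⟨ regroup N (y 0) ⟩
  2 * ((y 0 * 2) * (y 0 * 2)) + 4 * (N * N)   ≤⟨ ℕP.+-monoˡ-≤ (4 * (N * N)) (ℕP.*-monoʳ-≤ 2 (ℕP.*-mono-≤ (dy≤N 0) (dy≤N 0))) ⟩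
  2 * (N * N) + 4 * (N * N)                   ≡⟨ collect N ⟩
  3 * 2 * (N * N)                             ∎
  where
  open ℕP.≤-Reasoning
  regroup : ∀ N y → 4 * 2 * (0 + y * y) + 4 * (N * N) ≡ 2 * ((y * 2) * (y * 2)) + 4 * (N * N)
  regroup = ℕ-Ring.solve-∀
  collect : ∀ N → 2 * (N * N) + 4 * (N * N) ≡ 3 * 2 * (N * N)
  collect = ℕ-Ring.solve-∀
square-sum-bound N y dy≤N (suc j) =
  telescoping-step N (2 + j) (Σ< (λ e → y e * y e) (suc j)) (y (suc j)) (s≤s z≤n) (dy≤N (suc j)) (square-sum-bound N y dy≤N j)

cover-bound : ∀ N → 4 * length (cover N N) ≤ 3 * (N * N)
cover-bound zero        = z≤n
cover-bound N@(suc j)   = subst (λ c → 4 * c ≤ 3 * (N * N)) (sym (length-cover N N)) (ℕP.*-cancelˡ-≤ (suc N) (begin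
  suc N * (4 * C)                      ≤⟨ ℕP.m≤m+n _ _ ⟩
  suc N * (4 * C) + 4 * (N * N)        ≡⟨ cong (_+ 4 * (N * N)) (reassoc (suc N) C) ⟩
  4 * suc N * C + 4 * (N * N)          ≤⟨ square-sum-bound N (λ e → N / (2 + e)) (λ e → DM.m/n*n≤m N (2 + e)) j ⟩
  3 * suc N * (N * N)                  ≡⟨ reassoc′ (suc N) (N * N) ⟩
  suc N * (3 * (N * N))                ∎))
  where
  open ℕP.≤-Reasoning
  C = Σ< (λ e → (N / (2 + e)) * (N / (2 + e))) N
  reassoc : ∀ n c → n * (4 * c) ≡ 4 * n * c
  reassoc = ℕ-Ring.solve-∀
  reassoc′ : ∀ n m → 3 * n * m ≡ n * (3 * m)
  reassoc′ = ℕ-Ring.solve-∀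

quotient-∈-range : ∀ N d .{{_ : ℕ.NonZero d}} {a} q → a ≡ q * d → 1 ≤ a → a ≤ N → q ∈ range (N / d)
quotient-∈-range N d zero    refl ()
quotient-∈-range N d (suc q) a≡ 1≤a a≤N =
  ∈-range (s≤s z≤n) (subst (_≤ N / d) (DM.m*n/n≡m (suc q) d) (DM./-monoˡ-≤ d (subst (_≤ N) a≡ a≤N)))

-- a pair in [1 , N]² with gcd g ≥ 2 is g times a pair in [1 , N / g]², so it lies in the cover
non-coprime-∈-cover : ∀ N {a c} → (a , c) ∈ square N → ¬ C.Coprime a c → (a , c) ∈ cover N N
non-coprime-∈-cover N {a} {c} ac∈ ¬coprime with ∈-square⁻ ac∈
... | (1≤a , a≤N) , (1≤c , c≤N)
    with GCD.gcd a c in g≡ | GCD.gcd[m,n]∣m a c | GCD.gcd[m,n]∣n a c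
...   | zero        | 0∣a | _ = ⊥-elim (ℕP.<⇒≢ 1≤a (sym (ND.0∣⇒≡0 0∣a)))
...   | suc zero    | _   | _ = ⊥-elim (¬coprime (C.gcd≡1⇒coprime g≡))
...   | suc (suc e) | ND.divides q a≡ | ND.divides q′ c≡ = ∈-cover N N e e<N ac∈multiples
  where
  g = 2 + e
  e<N : e < N
  e<N = ℕP.≤-trans (ℕP.m≤n+m (suc e) 1) (ℕP.≤-trans (ND.∣⇒≤ {{ℕ.>-nonZero 1≤a}} (subst (ND._∣ a) g≡ (GCD.gcd[m,n]∣m a c))) a≤N)
  ac∈multiples : (a , c) ∈ multiples N g
  ac∈multiples = subst (_∈ multiples N g) (cong₂ _,_ (trans (ℕP.*-comm g q) (sym a≡)) (trans (ℕP.*-comm g q′) (sym c≡)))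
    (MP.∈-map⁺ _ (MP.∈-cartesianProduct⁺ (quotient-∈-range N g q a≡ 1≤a a≤N) (quotient-∈-range N g q′ c≡ 1≤c c≤N)))

CoprimePair : ℕ × ℕ → Set
CoprimePair (a , c) = C.Coprime a c

coprimePair? : ∀ ac → Dec (CoprimePair ac)
coprimePair? (a , c) = C.coprime? a c

coprimePairs : ℕ → List (ℕ × ℕ)
coprimePairs N = filter coprimePair? (square N)

-- every pair of [1 , N]² is coprime or in the cover, and the cover has ≤ ¾ N² entries
coprime-pairs-bound : ∀ N → N * N ≤ 4 * length (coprimePairs N)
coprime-pairs-bound N = ℕP.+-cancelʳ-≤ (3 * (N * N)) _ _ (begin
  N * N + 3 * (N * N)                       ≡⟨ four (N * N) ⟩
  4 * (N * N)                               ≡⟨ cong (4 *_) (sym (length-square N)) ⟩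
  4 * length (square N)                     ≤⟨ ℕP.*-monoʳ-≤ 4 (unique⊆⇒length≤ (square N) (coprimePairs N ++ cover N N) (square-unique N) covered) ⟩
  4 * length (coprimePairs N ++ cover N N)  ≡⟨ cong (4 *_) (LP.length-++ (coprimePairs N)) ⟩
  4 * (P + length (cover N N))              ≡⟨ ℕP.*-distribˡ-+ 4 P (length (cover N N)) ⟩
  4 * P + 4 * length (cover N N)            ≤⟨ ℕP.+-monoʳ-≤ (4 * P) (cover-bound N) ⟩
  4 * P + 3 * (N * N)                       ∎)
  where
  open ℕP.≤-Reasoning
  P = length (coprimePairs N)
  four : ∀ n → n + 3 * n ≡ 4 * n
  four = ℕ-Ring.solve-∀
  covered : ∀ {ac} → ac ∈ square N → ac ∈ coprimePairs N ++ cover N N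
  covered {a , c} ac∈ with C.coprime? a c
  ... | yes coprime = MP.∈-++⁺ˡ (MP.∈-filter⁺ coprimePair? ac∈ coprime)
  ... | no ¬coprime = MP.∈-++⁺ʳ (coprimePairs N) (non-coprime-∈-cover N ac∈ ¬coprime)

-- §12  Φ (a , a + c) is a minimal model when a and c are coprime.

prime-factor : ∀ d → 2 ≤ d → Σ ℕ λ p → Prime p × p ND.∣ d
prime-factor (suc zero) (s≤s ())
prime-factor d@(suc (suc _)) _ with factorise d
... | record { factors = [] ; isFactorisation = () }
... | record { factors = p ∷ ps ; isFactorisation = d≡ ; factorsPrime = p-prime ∷ _ } =
  p , p-prime , ND.divides (product ps) (trans d≡ (ℕP.*-comm p (product ps)))

prime-∣-power : ∀ {p} m k → Prime p → p ND.∣ m ^ suc k → p ND.∣ m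
prime-∣-power m zero p-prime p∣m¹ with euclidsLemma m 1 p-prime p∣m¹
... | inj₁ p∣m = p∣m
... | inj₂ p∣1 = ⊥-elim (¬prime[1] (subst Prime (ND.∣1⇒≡1 p∣1) p-prime))
prime-∣-power m (suc k) p-prime p∣mᵏ⁺² with euclidsLemma m (m ^ suc k) p-prime p∣mᵏ⁺²
... | inj₁ p∣m  = p∣m
... | inj₂ p∣mᵏ = prime-∣-power m k p-prime p∣mᵏ

QA QB : ℕ → ℕ → ℕ
QA a b = a * a + a * b + b * b
QB a b = a * b * (a + b)

abs-φA : ∀ a b → ∣ φA (+ a) (+ b) ∣ ≡ QA a b
abs-φA a b = trans (ℤP.∣-i∣≡∣i∣ (+ a ℤ.* + a ℤ.+ + a ℤ.* + b ℤ.+ + b ℤ.* + b))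
  (cong ∣_∣ (cong₂ ℤ._+_ (cong₂ ℤ._+_ (ℤP.+◃n≡+n (a * a)) (ℤP.+◃n≡+n (a * b))) (ℤP.+◃n≡+n (b * b))))

abs-φB : ∀ a b → ∣ φB (+ a) (+ b) ∣ ≡ QB a b
abs-φB a b = cong ∣_∣ (trans (cong (ℤ._* (+ a ℤ.+ + b)) (ℤP.+◃n≡+n (a * b))) (ℤP.+◃n≡+n (a * b * (a + b))))

split-QA₁ : ∀ a b → a * a + a * b + b * b ≡ b * (a + b) + a * a
split-QA₁ = ℕ-Ring.solve-∀

split-QA₂ : ∀ a b → a * a + a * b + b * b ≡ (a + b) * a + b * b
split-QA₂ = ℕ-Ring.solve-∀

split-QA₃ : ∀ a b → a * a + a * b + b * b ≡ (a + b) * b + a * a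
split-QA₃ = ℕ-Ring.solve-∀

module _ {p} (p-prime : Prime p) where

  prime-∣-square : ∀ {x} → p ND.∣ x * x → p ND.∣ x
  prime-∣-square {x} p∣x² with euclidsLemma x x p-prime p∣x²
  ... | inj₁ p∣x = p∣x
  ... | inj₂ p∣x = p∣x

  cancel-from-QA : ∀ a b u v y → QA a b ≡ u * v + y * y → p ND.∣ QA a b → p ND.∣ v → p ND.∣ y
  cancel-from-QA a b u v y QA≡ p∣QA p∣v =
    prime-∣-square (ND.∣m+n∣m⇒∣n (subst (p ND.∣_) QA≡ p∣QA) (ND.∣-trans p∣v (ND.n∣m*n u)))

  prime-∣-QA-QB : ∀ a b → p ND.∣ QA a b → p ND.∣ QB a b → p ND.∣ a × p ND.∣ b
  prime-∣-QA-QB a b p∣QA p∣QB with euclidsLemma (a * b) (a + b) p-prime p∣QB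
  ... | inj₂ p∣a+b = p∣a , ND.∣m+n∣m⇒∣n p∣a+b p∣a
    where p∣a = cancel-from-QA a b b (a + b) a (split-QA₁ a b) p∣QA p∣a+b
  ... | inj₁ p∣ab with euclidsLemma a b p-prime p∣ab
  ...   | inj₁ p∣a = p∣a , cancel-from-QA a b (a + b) a b (split-QA₂ a b) p∣QA p∣a
  ...   | inj₂ p∣b = cancel-from-QA a b (a + b) b a (split-QA₃ a b) p∣QA p∣b , p∣b

-- Φ (a , a + c) is a minimal model when a and c are coprime: a prime factor p of
-- some d ≥ 2 with d¹² ∣ gcd (A³ , B²) would divide A and B, hence a and c
coprime⇒minimal : ∀ a c → C.Coprime a c → Minimal (φA (+ a) (+ (a + c))) (φB (+ a) (+ (a + c)))
coprime⇒minimal a c coprime d 2≤d d¹²∣gcd = ¬prime[1] (subst Prime (coprime (p∣a , p∣c)) p-prime)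
  where
  b = a + c
  p = proj₁ (prime-factor d 2≤d)
  p-prime = proj₁ (proj₂ (prime-factor d 2≤d))
  p∣d = proj₂ (proj₂ (prime-factor d 2≤d))
  g = GCD.gcd (QA a b ^ 3) (QB a b ^ 2)
  p∣g : p ND.∣ g
  p∣g = ND.∣-trans p∣d (ND.∣-trans (ND.m∣m*n (d ^ 11))
          (subst (λ x → (d ^ 12) ND.∣ x) (cong₂ (λ x y → GCD.gcd (x ^ 3) (y ^ 2)) (abs-φA a b) (abs-φB a b)) d¹²∣gcd))
  p∣ab = prime-∣-QA-QB p-prime a b (prime-∣-power (QA a b) 2 p-prime (ND.∣-trans p∣g (GCD.gcd[m,n]∣m (QA a b ^ 3) (QB a b ^ 2))))
                                   (prime-∣-power (QB a b) 1 p-prime (ND.∣-trans p∣g (GCD.gcd[m,n]∣n (QA a b ^ 3) (QB a b ^ 2))))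
  p∣a = proj₁ p∣ab
  p∣c = ND.∣m+n∣m⇒∣n (proj₂ p∣ab) p∣a

-- §13  Lower bound: the curves Φ (a , a + c) with 1 ≤ a , c ≤ N coprime are distinct,
-- counted and of height ≤ 343 N⁶.

-- the curve with roots a , a + c , -(2a + c)
ψ : ℕ × ℕ → ℤ × ℤ
ψ (a , c) = Φ (+ a , + (a + c))

ψ-split : ∀ a c → 1 ≤ a → 1 ≤ c → Split (φA (+ a) (+ (a + c))) (φB (+ a) (+ (a + c)))
ψ-split a@(suc _) c@(suc _) _ _ = (+ a , + (a + c)) , a≢a+c , (λ ()) , (λ ()) , refl , refl
  where
  a≢a+c : + a ≢ + (a + c)
  a≢a+c eq = ℕP.m+1+n≢m a (sym (ℤP.+-injective eq))

-- ∣ A ∣ ≤ 7 N² and ∣ B ∣ ≤ 6 N³, so the height is at most 343 N⁶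
ψ-height : ∀ N X a c → a ≤ N → c ≤ N → 343 * N ^ 6 ≤ X →
           height (φA (+ a) (+ (a + c))) (φB (+ a) (+ (a + c))) ≤ X
ψ-height N X a c a≤N c≤N 343N⁶≤X =
  subst (_≤ X) (sym (cong₂ (λ x y → x ^ 3 ℕ.⊔ y ^ 2) (abs-φA a b) (abs-φB a b))) (ℕP.⊔-lub A³≤X B²≤X)
  where
  open ℕP.≤-Reasoning
  open ℕ-Solver.+-*-Solver
  b = a + c
  b≤2N : b ≤ N + N
  b≤2N = ℕP.+-mono-≤ a≤N c≤N
  A³≤X : QA a b ^ 3 ≤ X
  A³≤X = begin
    QA a b ^ 3                                       ≤⟨ ℕP.^-monoˡ-≤ 3 (ℕP.+-mono-≤ (ℕP.+-mono-≤ (ℕP.*-mono-≤ a≤N a≤N) (ℕP.*-mono-≤ a≤N b≤2N)) (ℕP.*-mono-≤ b≤2N b≤2N)) ⟩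
    (N * N + N * (N + N) + (N + N) * (N + N)) ^ 3    ≡⟨ solve 1 (λ N → (N :* N :+ N :* (N :+ N) :+ (N :+ N) :* (N :+ N)) :^ 3 := con 343 :* N :^ 6) refl N ⟩
    343 * N ^ 6                                      ≤⟨ 343N⁶≤X ⟩
    X                                                ∎
  B²≤X : QB a b ^ 2 ≤ X
  B²≤X = begin
    QB a b ^ 2                                       ≤⟨ ℕP.^-monoˡ-≤ 2 (ℕP.*-mono-≤ (ℕP.*-mono-≤ a≤N b≤2N) (ℕP.+-mono-≤ a≤N b≤2N)) ⟩
    (N * (N + N) * (N + (N + N))) ^ 2                ≡⟨ solve 1 (λ N → (N :* (N :+ N) :* (N :+ (N :+ N))) :^ 2 := con 36 :* N :^ 6) refl N ⟩
    36 * N ^ 6                                       ≤⟨ ℕP.*-monoˡ-≤ (N ^ 6) {36} {343} (ℕP.m≤m+n 36 307) ⟩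
    343 * N ^ 6                                      ≤⟨ 343N⁶≤X ⟩
    X                                                ∎

positive≢third : ∀ t a b → + suc t ≢ third (+ a) (+ b)
positive≢third t a b eq = case trans (sym (ℤP.neg-involutive (+ a ℤ.+ + b))) (cong ℤ.-_ (sym eq)) of λ ()

positive-root : ∀ a b t → 1 ≤ t → cubic (φA (+ a) (+ b)) (φB (+ a) (+ b)) (+ t) ≡ + 0 → t ≡ a ⊎ t ≡ b
positive-root a b t@(suc t-1) _ root with split-root (+ a) (+ b) (+ t) root
... | inj₁ t≡a        = inj₁ (ℤP.+-injective t≡a)
... | inj₂ (inj₁ t≡b) = inj₂ (ℤP.+-injective t≡b)
... | inj₂ (inj₂ t≡c) = ⊥-elim (positive≢third t-1 a b t≡c)

-- ψ is injective on positive pairs: the positive roots a < a + c of ψ (a , c) recover (a , c)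
ψ-injective : ∀ a c a′ c′ → 1 ≤ c → 1 ≤ a′ → 1 ≤ c′ → ψ (a , c) ≡ ψ (a′ , c′) → (a , c) ≡ (a′ , c′)
ψ-injective a c@(suc _) a′ c′@(suc _) _ 1≤a′ _ ψ≡ =
  match (positive-root a b a′ 1≤a′ (root-of a′ (proj₁ (roots-of-split (+ a′) (+ b′)))))
        (positive-root a b b′ (ℕP.≤-trans 1≤a′ (ℕP.m≤m+n a′ c′)) (root-of b′ (proj₁ (proj₂ (roots-of-split (+ a′) (+ b′))))))
  where
  b = a + c
  b′ = a′ + c′
  root-of : ∀ t → cubic (φA (+ a′) (+ b′)) (φB (+ a′) (+ b′)) (+ t) ≡ + 0 →
            cubic (φA (+ a) (+ b)) (φB (+ a) (+ b)) (+ t) ≡ + 0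
  root-of t = subst (λ AB → cubic (proj₁ AB) (proj₂ AB) (+ t) ≡ + 0) (sym ψ≡)
  match : a′ ≡ a ⊎ a′ ≡ b → b′ ≡ a ⊎ b′ ≡ b → (a , c) ≡ (a′ , c′)
  match (inj₁ refl) (inj₂ b′≡b) = cong (a ,_) (sym (ℕP.+-cancelˡ-≡ a _ _ b′≡b))
  match (inj₁ refl) (inj₁ b′≡a) = ⊥-elim (ℕP.m+1+n≢m a b′≡a)
  match (inj₂ refl) (inj₁ b′≡a) = ⊥-elim (ℕP.m+1+n≢m a (trans (sym (ℕP.+-assoc a c c′)) b′≡a))
  match (inj₂ refl) (inj₂ b′≡b) = ⊥-elim (ℕP.m+1+n≢m b b′≡b)

coprime-pairs≤count : ∀ X N → 343 * N ^ 6 ≤ X → length (coprimePairs N) ≤ length (counted X)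
coprime-pairs≤count X N 343N⁶≤X =
  injection⇒length≤ ψ (coprimePairs N) (counted X) (UP.filter⁺ coprimePair? (square-unique N)) injective into
  where
  info : ∀ {ac} → ac ∈ coprimePairs N →
         ((1 ≤ proj₁ ac × proj₁ ac ≤ N) × (1 ≤ proj₂ ac × proj₂ ac ≤ N)) × CoprimePair ac
  info {a , c} ac∈ with MP.∈-filter⁻ coprimePair? {xs = square N} ac∈
  ... | ac∈square , coprime = ∈-square⁻ ac∈square , coprime
  injective : InjectiveOn ψ (coprimePairs N)
  injective {a , c} {a′ , c′} ac∈ ac′∈ with info ac∈ | info ac′∈
  ... | (_ , (1≤c , _)) , _ | ((1≤a′ , _) , (1≤c′ , _)) , _ = ψ-injective a c a′ c′ 1≤c 1≤a′ 1≤c′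
  into : ∀ {ac} → ac ∈ coprimePairs N → ψ ac ∈ counted X
  into {a , c} ac∈ with info ac∈
  ... | ((1≤a , a≤N) , (1≤c , c≤N)) , coprime = counted-complete X (ψ (a , c))
    ( split⇒nonsingular _ _ split , coprime⇒minimal a c coprime
    , ψ-height N X a c a≤N c≤N 343N⁶≤X , split⇒subgroup _ _ split )
    where split = ψ-split a c 1≤a 1≤c

-- y² = x³ - x (roots 0 , ±1) is counted as soon as X ≥ 1
counted-nonempty : ∀ X → 1 ≤ X → 1 ≤ length (counted X)
counted-nonempty X 1≤X = nonempty (counted-complete X (-[1+ 0 ] , + 0) (nonsingular , minimal , 1≤X , subgroup))
  where
  nonempty : ∀ {A : Set} {x : A} {xs} → x ∈ xs → 1 ≤ length xs
  nonempty {xs = _ ∷ _} _ = s≤s z≤n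
  split : Split -[1+ 0 ] (+ 0)
  split = (+ 1 , -[1+ 0 ]) , (λ ()) , (λ ()) , (λ ()) , refl , refl
  nonsingular = split⇒nonsingular _ _ split
  subgroup = split⇒subgroup _ _ split
  minimal : Minimal -[1+ 0 ] (+ 0)
  minimal d 2≤d d¹²∣1 = ℕP.<⇒≱ 2≤d (ℕP.≤-trans (d≤d^12 d) (ℕP.≤-reflexive (ND.∣1⇒≡1 d¹²∣1)))

-- X ≤ 343 (N + 1)⁶ ≤ 343 · 64 N⁶ ≤ 343 · 64 · 64 n³ once N² ≤ 4 n (and X ≤ 343 ≤ C n³ if N = 0)
lower-arithmetic : ∀ X N n → X ≤ 343 * suc N ^ 6 → N * N ≤ 4 * n → 1 ≤ n → X ≤ 1404928 * n ^ 3
lower-arithmetic X zero n X≤343 _ 1≤n = begin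
  X                   ≤⟨ X≤343 ⟩
  343                 ≤⟨ ℕP.m≤m+n 343 1404585 ⟩
  1404928 * 1         ≤⟨ ℕP.*-monoʳ-≤ 1404928 (ℕP.^-monoˡ-≤ 3 1≤n) ⟩
  1404928 * n ^ 3     ∎
  where open ℕP.≤-Reasoning
lower-arithmetic X N@(suc _) n X≤ N²≤4n _ = begin
  X                           ≤⟨ X≤ ⟩
  343 * suc N ^ 6             ≤⟨ ℕP.*-monoʳ-≤ 343 (ℕP.^-monoˡ-≤ 6 (ℕP.+-monoˡ-≤ N {1} {N} (s≤s z≤n))) ⟩
  343 * (N + N) ^ 6           ≡⟨ cong (343 *_) (double⁶ N) ⟩
  343 * (64 * (N * N) ^ 3)    ≡⟨ sym (ℕP.*-assoc 343 64 ((N * N) ^ 3)) ⟩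
  21952 * (N * N) ^ 3         ≤⟨ ℕP.*-monoʳ-≤ 21952 (ℕP.^-monoˡ-≤ 3 N²≤4n) ⟩
  21952 * (4 * n) ^ 3         ≡⟨ cong (21952 *_) (quadruple³ n) ⟩
  21952 * (64 * n ^ 3)        ≡⟨ sym (ℕP.*-assoc 21952 64 (n ^ 3)) ⟩
  1404928 * n ^ 3             ∎
  where
  open ℕP.≤-Reasoning
  open ℕ-Solver.+-*-Solver
  double⁶ : ∀ N → (N + N) ^ 6 ≡ 64 * (N * N) ^ 3
  double⁶ = solve 1 (λ N → (N :+ N) :^ 6 := con 64 :* (N :* N) :^ 3) refl
  quadruple³ : ∀ n → (4 * n) ^ 3 ≡ 64 * n ^ 3
  quadruple³ = solve 1 (λ n → (con 4 :* n) :^ 3 := con 64 :* n :^ 3) refl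

maximal⇒X-bound : ∀ X N → (∀ k → k ≤ X → 343 * k ^ 6 ≤ X → k ≤ N) → X ≤ 343 * suc N ^ 6
maximal⇒X-bound X N maximal with (343 * suc N ^ 6) ℕP.≤? X
... | no  X<bound = ℕP.<⇒≤ (ℕP.≰⇒> X<bound)
... | yes bound≤X = ⊥-elim (ℕP.n≮n N (maximal (suc N) N+1≤X bound≤X))
  where N+1≤X = ℕP.≤-trans (ℕP.≤-trans (m≤m^[1+k] (suc N) 5) (ℕP.m≤n*m (suc N ^ 6) 343)) bound≤X

-- Lower bound: with N maximal among 343 N⁶ ≤ X, the coprime pairs of [1 , N]²
-- give N² ≤ 4 N'_G(X), while X < 343 (N + 1)⁶.
lower-bound : ∀ X → 1 ≤ X → X ≤ 1404928 * length (counted X) ^ 3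
lower-bound X 1≤X =
  lower-arithmetic X N n (maximal⇒X-bound X N maximal) N²≤4n (counted-nonempty X 1≤X)
  where
  N-maximal = largest (λ m → 343 * m ^ 6 ≤ X) (λ m → (343 * m ^ 6) ℕP.≤? X) z≤n X
  N = proj₁ N-maximal
  maximal = proj₂ (proj₂ (proj₂ N-maximal))
  n = length (counted X)
  N²≤4n : N * N ≤ 4 * n
  N²≤4n = ℕP.≤-trans (coprime-pairs-bound N) (ℕP.*-monoʳ-≤ 4 (coprime-pairs≤count X N (proj₁ (proj₂ (proj₂ N-maximal)))))

-- N'_G(X) is the length of the counted list; the two bounds hold with C = 1404928 ≥ 3⁷.
proposition4p3 : ∃[ C ] ((X : ℕ) → 1 ≤ X →
    ∃[ n ] (IsCount (CountedG X) n × n ^ 3 ≤ C * X × X ≤ C * n ^ 3))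
proposition4p3 = 1404928 , λ X 1≤X →
  length (counted X) ,
  counted-isCount X ,
  ℕP.≤-trans (upper-bound X 1≤X) (ℕP.*-monoˡ-≤ X {2187} {1404928} (ℕP.m≤m+n 2187 1402741)) ,
  lower-bound X 1≤X
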